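{- For integers $m,n\geq 2$, $$\chi'_s(P_m\square P_n)=\begin{cases}3 & \text{if } m=n=2,\\ 4 & \text{if } (m=2,\ n\geq 3)\text{ or }(m\geq 3,\ n=2),\\ 5 & \text{if } (m\in\{3,4\},\ n=3)\text{ or }(m=3,\ n\in\{3,4\}),\\ 6 & \text{otherwise.}\end{cases}$$
   Context: $P_n$ is the path on $n$ vertices. A star edge coloring of a graph is a proper edge coloring such that no path or cycle with four edges uses at most two colors; the star chromatic index $\chi'_s(G)$ is the minimum number of colors in a star edge coloring of $G$. The Cartesian product $G\square H$ has vertex set $V(G)\times V(H)$, with $(a,x)(b,y)$ an edge iff either $ab\in E(G)$ and $x=y$, or $xy\in E(H)$ and $a=b$. -}

module Defs where

open import Data.Nat using (ℕ; zero; suc; _<_)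
open import Data.Fin using (Fin; toℕ)
open import Data.Product using (_×_; Σ; ∃; ∃-syntax; _,_)
open import Data.Sum using (_⊎_)
open import Relation.Binary.PropositionalEquality using (_≡_; _≢_)
open import Relation.Nullary using (¬_)

record Graph : Set₁ where
  field
    V   : Set
    Adj : V → V → Set
open Graph public

P : ℕ → Graph
V (P n) = Fin n
Adj (P n) i j = (suc (toℕ i) ≡ toℕ j) ⊎ (suc (toℕ j) ≡ toℕ i)

_□_ : Graph → Graph → Graph
V (G □ H) = V G × V H
Adj (G □ H) (a , x) (b , y) = (Adj G a b × x ≡ y) ⊎ (Adj H x y × a ≡ b)

-- An edge colouring with k colours assigns to every ordered pair of vertices
-- a colour; only its values on edges matter, and it must be symmetric there
-- (so it is really a colouring of the undirected edges).
module _ (G : Graph) where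

  EdgeColouring : ℕ → Set
  EdgeColouring k = V G → V G → Fin k

  Symmetric : ∀ {k} → EdgeColouring k → Set
  Symmetric c = ∀ u v → Adj G u v → c u v ≡ c v u

  Proper : ∀ {k} → EdgeColouring k → Set
  Proper c = ∀ u v w → Adj G u v → Adj G v w → u ≢ w → c u v ≢ c v w

  AtMostTwo : ∀ {k} → Fin k → Fin k → Fin k → Fin k → Set
  AtMostTwo {k} x₁ x₂ x₃ x₄ =
    ∃[ a ] ∃[ b ] ((x₁ ≡ a ⊎ x₁ ≡ b) × (x₂ ≡ a ⊎ x₂ ≡ b) ×
                   (x₃ ≡ a ⊎ x₃ ≡ b) × (x₄ ≡ a ⊎ x₄ ≡ b))

  Path4 : V G → V G → V G → V G → V G → Set
  Path4 v₀ v₁ v₂ v₃ v₄ =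
    (Adj G v₀ v₁ × Adj G v₁ v₂ × Adj G v₂ v₃ × Adj G v₃ v₄) ×
    (v₀ ≢ v₁ × v₀ ≢ v₂ × v₀ ≢ v₃ × v₀ ≢ v₄ ×
     v₁ ≢ v₂ × v₁ ≢ v₃ × v₁ ≢ v₄ ×
     v₂ ≢ v₃ × v₂ ≢ v₄ × v₃ ≢ v₄)

  Cycle4 : V G → V G → V G → V G → Set
  Cycle4 v₀ v₁ v₂ v₃ =
    (Adj G v₀ v₁ × Adj G v₁ v₂ × Adj G v₂ v₃ × Adj G v₃ v₀) ×
    (v₀ ≢ v₁ × v₀ ≢ v₂ × v₀ ≢ v₃ × v₁ ≢ v₂ × v₁ ≢ v₃ × v₂ ≢ v₃)

  IsStarEdgeColouring : ∀ {k} → EdgeColouring k → Set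
  IsStarEdgeColouring c =
    Symmetric c × Proper c ×
    (∀ v₀ v₁ v₂ v₃ v₄ → Path4 v₀ v₁ v₂ v₃ v₄ →
       ¬ AtMostTwo (c v₀ v₁) (c v₁ v₂) (c v₂ v₃) (c v₃ v₄)) ×
    (∀ v₀ v₁ v₂ v₃ → Cycle4 v₀ v₁ v₂ v₃ →
       ¬ AtMostTwo (c v₀ v₁) (c v₁ v₂) (c v₂ v₃) (c v₃ v₀))

  StarColourable : ℕ → Set
  StarColourable k = Σ (EdgeColouring k) IsStarEdgeColouring

  StarChromaticIndex≡ : ℕ → Set
  StarChromaticIndex≡ k = StarColourable k × (∀ j → j < k → ¬ StarColourable j)

module Submission where

-- First the star
-- condition is restated as "no alternating path or 4-cycle", the form in
-- which it transfers along renamings of colours and maps of graphs.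
--
-- A fold G → H preserves adjacency and keeps apart the ends
-- of every path with one or two edges.  Pulling back along a fold turns a
-- colouring of H without alternating non-backtracking 4-walks into a star
-- colouring of G.  Since P_m winds around the cycle C_q and products of
-- folds are folds, one colouring of C₃ □ C₃ with 6 colours serves all
-- grids, one of P₂ □ C₄ with 4 colours serves all ladders, and P₂ □ P₂,
-- P₃ □ P₃, P₃ □ P₄ are coloured directly; these finite colourings are
-- checked by a decision procedure.
--
-- Star colourings restrict to subgraphs, and a transposed
-- grid is a subgraph, so it suffices to exclude star colourings of P₂ □ P₂,
-- P₂ □ P₃, P₃ □ P₃, P₃ □ P₅ and P₄ □ P₄ with 2, 3, 4, 5, 5 colours.  This
-- is a verified exhaustive search: after renaming colours a fixed 2-path
-- gets colours 0, 1; the other edges are coloured one at a time, and every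
-- branch is closed by a certificate pattern (two equal adjacent colours, or
-- an alternating path or 4-cycle).

open import Defs
open import Data.Bool using (Bool; true; false; T; _∨_; if_then_else_)
open import Data.Bool.ListAction using (all; any)
open import Data.Bool.Properties using (T-∨)
open import Data.Empty using (⊥-elim)
open import Data.Fin as Fin using (Fin; toℕ; inject≤; fromℕ<; #_)
open import Data.Fin.Patterns using (0F; 1F; 2F; 3F; 4F; 5F)
open import Data.Fin.Permutation.Components using (transpose; transpose-inverse)
open import Data.Fin.Properties
  using (toℕ-injective; inject≤-injective; toℕ-inject≤; toℕ-fromℕ<; all?)
  renaming (_≟_ to _≟ᶠ_)
open import Data.List using (List; []; _∷_; allFin)
open import Data.List.Membership.Propositional.Properties using (∈-allFin)
open import Data.List.Relation.Unary.All as All using (All; []; _∷_)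
open import Data.List.Relation.Unary.All.Properties using (all⁺)
open import Data.List.Relation.Unary.Any.Properties using (any⁻)
open import Data.Nat using (ℕ; suc; _+_; _≤_; _<_; s≤s; _≤?_; _≡ᵇ_; NonZero)
open import Data.Nat.DivMod using (_mod_)
open import Data.Nat.GeneralisedArithmetic using (fold)
open import Data.Nat.Properties
  using (≤-refl; ≤-pred; suc-injective; m≤m+n; m≤n+m; +-suc; +-comm; 1+n≢n; ≡ᵇ⇒≡; ≡⇒≡ᵇ; m≤n⇒m<n∨m≡n)
  renaming (_≟_ to _≟ℕ_)
open import Data.Product using (_×_; Σ; _,_; proj₁; proj₂; uncurry)
open import Data.Product.Properties using (,-injective; ≡-dec)
open import Data.Sum using (_⊎_; inj₁; inj₂; [_,_])
open import Data.Unit using (⊤; tt)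
open import Data.Vec using (Vec; lookup; []; _∷_)
open import Function using (_∘_; Equivalence)
open import Relation.Binary.Definitions using (DecidableEquality)
open import Relation.Binary.PropositionalEquality
  using (_≡_; _≢_; refl; sym; trans; cong; cong₂; subst; module ≡-Reasoning)
open import Relation.Nullary using (¬_; Dec; yes; no; does)
open import Relation.Nullary.Decidable
  using (True; isYes; toWitness; map′; _×-dec_; _⊎-dec_; _→-dec_; ¬?)

Alternating : ∀ {k} → Fin k → Fin k → Fin k → Fin k → Set
Alternating x₁ x₂ x₃ x₄ = x₁ ≡ x₃ × x₂ ≡ x₄

otherValue : ∀ {A : Set} {a b x y z : A} →
  (x ≡ a ⊎ x ≡ b) → (y ≡ a ⊎ y ≡ b) → (z ≡ a ⊎ z ≡ b) → x ≢ y → z ≢ y → x ≡ z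
otherValue (inj₁ refl) (inj₁ refl) _           x≢y _   = ⊥-elim (x≢y refl)
otherValue (inj₂ refl) (inj₂ refl) _           x≢y _   = ⊥-elim (x≢y refl)
otherValue _           (inj₁ refl) (inj₁ refl) _   z≢y = ⊥-elim (z≢y refl)
otherValue _           (inj₂ refl) (inj₂ refl) _   z≢y = ⊥-elim (z≢y refl)
otherValue (inj₁ refl) (inj₂ refl) (inj₁ refl) _   _   = refl
otherValue (inj₂ refl) (inj₁ refl) (inj₂ refl) _   _   = refl

atMostTwo⇒alternating : ∀ G {k} {x₁ x₂ x₃ x₄ : Fin k} →
  x₁ ≢ x₂ → x₂ ≢ x₃ → x₃ ≢ x₄ →
  AtMostTwo G x₁ x₂ x₃ x₄ → Alternating x₁ x₂ x₃ x₄
atMostTwo⇒alternating G x₁≢x₂ x₂≢x₃ x₃≢x₄ (_ , _ , p₁ , p₂ , p₃ , p₄) =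
  otherValue p₁ p₂ p₃ x₁≢x₂ (x₂≢x₃ ∘ sym) , otherValue p₂ p₃ p₄ x₂≢x₃ (x₃≢x₄ ∘ sym)

alternating⇒atMostTwo : ∀ G {k} {x₁ x₂ x₃ x₄ : Fin k} →
  Alternating x₁ x₂ x₃ x₄ → AtMostTwo G x₁ x₂ x₃ x₄
alternating⇒atMostTwo G {x₁ = x₁} {x₂} (refl , refl) =
  x₁ , x₂ , inj₁ refl , inj₂ refl , inj₁ refl , inj₂ refl

-- The star condition in terms of alternation, which is easier to transport
-- along maps of graphs and of colours.
module _ (G : Graph) {k : ℕ} (c : EdgeColouring G k) where

  NoAlternatingPath : Set
  NoAlternatingPath = ∀ v₀ v₁ v₂ v₃ v₄ → Path4 G v₀ v₁ v₂ v₃ v₄ →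
    ¬ Alternating (c v₀ v₁) (c v₁ v₂) (c v₂ v₃) (c v₃ v₄)

  NoAlternatingCycle : Set
  NoAlternatingCycle = ∀ v₀ v₁ v₂ v₃ → Cycle4 G v₀ v₁ v₂ v₃ →
    ¬ Alternating (c v₀ v₁) (c v₁ v₂) (c v₂ v₃) (c v₃ v₀)

  star⇒noAlternatingPath : IsStarEdgeColouring G c → NoAlternatingPath
  star⇒noAlternatingPath (_ , _ , noPath , _) v₀ v₁ v₂ v₃ v₄ path =
    noPath v₀ v₁ v₂ v₃ v₄ path ∘ alternating⇒atMostTwo G

  star⇒noAlternatingCycle : IsStarEdgeColouring G c → NoAlternatingCycle
  star⇒noAlternatingCycle (_ , _ , _ , noCycle) v₀ v₁ v₂ v₃ cycle =
    noCycle v₀ v₁ v₂ v₃ cycle ∘ alternating⇒atMostTwo G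

  noAlternating⇒star : Symmetric G c → Proper G c →
    NoAlternatingPath → NoAlternatingCycle → IsStarEdgeColouring G c
  noAlternating⇒star symmetric proper noPath noCycle =
    symmetric , proper ,
    (λ { v₀ v₁ v₂ v₃ v₄ path@((a₁ , a₂ , a₃ , a₄) , (_ , d₀₂ , _ , _ , _ , d₁₃ , _ , _ , d₂₄ , _)) →
         noPath v₀ v₁ v₂ v₃ v₄ path ∘
         atMostTwo⇒alternating G (proper _ _ _ a₁ a₂ d₀₂) (proper _ _ _ a₂ a₃ d₁₃)
                                 (proper _ _ _ a₃ a₄ d₂₄) }) ,
    (λ { v₀ v₁ v₂ v₃ cycle@((a₁ , a₂ , a₃ , a₄) , (_ , d₀₂ , _ , _ , d₁₃ , _)) →
         noCycle v₀ v₁ v₂ v₃ cycle ∘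
         atMostTwo⇒alternating G (proper _ _ _ a₁ a₂ d₀₂) (proper _ _ _ a₂ a₃ d₁₃)
                                 (proper _ _ _ a₃ a₄ (d₀₂ ∘ sym)) })

recolour : ∀ {G j k} (ι : Fin j → Fin k) → (∀ {x y} → ι x ≡ ι y → x ≡ y) →
  (c : EdgeColouring G j) → IsStarEdgeColouring G c →
  IsStarEdgeColouring G (λ u v → ι (c u v))
recolour {G} ι ι-injective c star@(symmetric , proper , _) =
  noAlternating⇒star G _
    (λ u v uv → cong ι (symmetric u v uv))
    (λ u v w uv vw u≢w → proper u v w uv vw u≢w ∘ ι-injective)
    (λ v₀ v₁ v₂ v₃ v₄ path (e₁ , e₂) →
       star⇒noAlternatingPath G c star v₀ v₁ v₂ v₃ v₄ path (ι-injective e₁ , ι-injective e₂))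
    (λ v₀ v₁ v₂ v₃ cycle (e₁ , e₂) →
       star⇒noAlternatingCycle G c star v₀ v₁ v₂ v₃ cycle (ι-injective e₁ , ι-injective e₂))

moreColours : ∀ {G j k} → j ≤ k → StarColourable G j → StarColourable G k
moreColours j≤k (c , star) =
  _ , recolour (λ x → inject≤ x j≤k) (inject≤-injective j≤k j≤k _ _) c star

fewerColours : ∀ {G k} → ¬ StarColourable G k → ∀ j → j < suc k → ¬ StarColourable G j
fewerColours noColouring j (s≤s j≤k) = noColouring ∘ moreColours j≤k

record Embedding (G H : Graph) : Set where
  field
    map          : V G → V H
    injective    : ∀ {u v} → map u ≡ map v → u ≡ v
    preservesAdj : ∀ {u v} → Adj G u v → Adj H (map u) (map v)

restrict : ∀ {G H k} → Embedding G H → StarColourable H k → StarColourable G k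
restrict {G} {H} e (c , star@(symmetric , proper , _)) =
  c′ , noAlternating⇒star G c′
         (λ u v → symmetric _ _ ∘ preservesAdj)
         (λ u v w uv vw u≢w → proper _ _ _ (preservesAdj uv) (preservesAdj vw) (separates u≢w))
         (λ v₀ v₁ v₂ v₃ v₄ → star⇒noAlternatingPath H c star _ _ _ _ _ ∘ mapPath)
         (λ v₀ v₁ v₂ v₃ → star⇒noAlternatingCycle H c star _ _ _ _ ∘ mapCycle)
  where
  open Embedding e
  c′ : EdgeColouring G _
  c′ u v = c (map u) (map v)
  separates : ∀ {u v} → u ≢ v → map u ≢ map v
  separates u≢v = u≢v ∘ injective
  mapPath : ∀ {v₀ v₁ v₂ v₃ v₄} → Path4 G v₀ v₁ v₂ v₃ v₄ →
            Path4 H (map v₀) (map v₁) (map v₂) (map v₃) (map v₄)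
  mapPath ((a₁ , a₂ , a₃ , a₄) , (d₀₁ , d₀₂ , d₀₃ , d₀₄ , d₁₂ , d₁₃ , d₁₄ , d₂₃ , d₂₄ , d₃₄)) =
    (preservesAdj a₁ , preservesAdj a₂ , preservesAdj a₃ , preservesAdj a₄) ,
    (separates d₀₁ , separates d₀₂ , separates d₀₃ , separates d₀₄ , separates d₁₂ ,
     separates d₁₃ , separates d₁₄ , separates d₂₃ , separates d₂₄ , separates d₃₄)
  mapCycle : ∀ {v₀ v₁ v₂ v₃} → Cycle4 G v₀ v₁ v₂ v₃ →
             Cycle4 H (map v₀) (map v₁) (map v₂) (map v₃)
  mapCycle ((a₁ , a₂ , a₃ , a₄) , (d₀₁ , d₀₂ , d₀₃ , d₁₂ , d₁₃ , d₂₃)) =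
    (preservesAdj a₁ , preservesAdj a₂ , preservesAdj a₃ , preservesAdj a₄) ,
    (separates d₀₁ , separates d₀₂ , separates d₀₃ , separates d₁₂ , separates d₁₃ , separates d₂₃)

_□ᵉ_ : ∀ {G G′ H H′} → Embedding G G′ → Embedding H H′ → Embedding (G □ H) (G′ □ H′)
_□ᵉ_ {G} {G′} {H} {H′} e f = record
  { map          = φ
  ; injective    = λ {(a , x)} {(b , y)} eq →
      let ea , fx = ,-injective eq in cong₂ _,_ (E.injective ea) (F.injective fx)
  ; preservesAdj = adj
  }
  where
  module E = Embedding e
  module F = Embedding f
  φ : V (G □ H) → V (G′ □ H′)
  φ (a , x) = E.map a , F.map x
  adj : ∀ {u v} → Adj (G □ H) u v → Adj (G′ □ H′) (φ u) (φ v)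
  adj (inj₁ (ab , refl)) = inj₁ (E.preservesAdj ab , refl)
  adj (inj₂ (xy , refl)) = inj₂ (F.preservesAdj xy , refl)

□-swap : ∀ {G H} → Embedding (G □ H) (H □ G)
□-swap {G} {H} = record { map = swap ; injective = λ { refl → refl } ; preservesAdj = adj }
  where
  swap : V (G □ H) → V (H □ G)
  swap (a , x) = x , a
  adj : ∀ {u v} → Adj (G □ H) u v → Adj (H □ G) (swap u) (swap v)
  adj (inj₁ r) = inj₂ r
  adj (inj₂ r) = inj₁ r

pathPrefix : ∀ {m n} → m ≤ n → Embedding (P m) (P n)
pathPrefix {m} {n} m≤n = record
  { map = ι ; injective = inject≤-injective m≤n m≤n _ _ ; preservesAdj = adj }
  where
  ι : Fin m → Fin n
  ι i = inject≤ i m≤n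
  adj : ∀ {i j} → Adj (P m) i j → Adj (P n) (ι i) (ι j)
  adj {i} {j} (inj₁ e) =
    inj₁ (trans (cong suc (toℕ-inject≤ i m≤n)) (trans e (sym (toℕ-inject≤ j m≤n))))
  adj {i} {j} (inj₂ e) =
    inj₂ (trans (cong suc (toℕ-inject≤ j m≤n)) (trans e (sym (toℕ-inject≤ i m≤n))))

_∘ᵉ_ : ∀ {G H K} → Embedding H K → Embedding G H → Embedding G K
f ∘ᵉ e = record
  { map          = F.map ∘ E.map
  ; injective    = E.injective ∘ F.injective
  ; preservesAdj = F.preservesAdj ∘ E.preservesAdj
  }
  where
  module E = Embedding e
  module F = Embedding f

Grid : ℕ → ℕ → Graph
Grid m n = P m □ P n

subgrid : ∀ {m n m′ n′} → m ≤ m′ → n ≤ n′ → Embedding (Grid m n) (Grid m′ n′)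
subgrid m≤m′ n≤n′ = pathPrefix m≤m′ □ᵉ pathPrefix n≤n′

transposed : ∀ {m n m′ n′} → n ≤ m′ → m ≤ n′ → Embedding (Grid m n) (Grid m′ n′)
transposed n≤m′ m≤n′ = subgrid n≤m′ m≤n′ ∘ᵉ □-swap

-- Unlike an embedding it may wrap G
-- around H, e.g. a long path around a short cycle.
record Fold (G H : Graph) : Set where
  field
    map          : V G → V H
    preservesAdj : ∀ {u v} → Adj G u v → Adj H (map u) (map v)
    separates₁   : ∀ {u v} → Adj G u v → map u ≢ map v
    separates₂   : ∀ {u v w} → Adj G u v → Adj G v w → u ≢ w → map u ≢ map w

-- The quantifiers are ordered so that deciding the
-- conditions only enumerates walks.
module _ (H : Graph) {k : ℕ} (c : EdgeColouring H k) where

  ProperAlongWalks : Set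
  ProperAlongWalks = ∀ u v → Adj H u v → ∀ w → Adj H v w → u ≢ w → c u v ≢ c v w

  NoAlternatingWalk : Set
  NoAlternatingWalk =
    ∀ v₀ v₁ → Adj H v₀ v₁ → ∀ v₂ → Adj H v₁ v₂ → v₀ ≢ v₂ →
    ∀ v₃ → Adj H v₂ v₃ → v₁ ≢ v₃ → ∀ v₄ → Adj H v₃ v₄ → v₂ ≢ v₄ →
    ¬ Alternating (c v₀ v₁) (c v₁ v₂) (c v₂ v₃) (c v₃ v₄)

  IsWalkStar : Set
  IsWalkStar = Symmetric H c × ProperAlongWalks × NoAlternatingWalk

-- Pulling back along a fold: paths and 4-cycles of G are mapped to walks
-- of H that never turn straight back, so they cannot alternate.
pullback : ∀ {G H k} → Fold G H → (c : EdgeColouring H k) → IsWalkStar H c →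
           StarColourable G k
pullback {G} {H} f c (symmetric , proper , noWalk) =
  c′ , noAlternating⇒star G c′
         (λ u v → symmetric _ _ ∘ preservesAdj)
         (λ u v w uv vw u≢w →
            proper _ _ (preservesAdj uv) _ (preservesAdj vw) (separates₂ uv vw u≢w))
         (λ { _ _ _ _ _ ((a₁ , a₂ , a₃ , a₄) , (_ , d₀₂ , _ , _ , _ , d₁₃ , _ , _ , d₂₄ , _)) →
              walk a₁ a₂ a₃ a₄ d₀₂ d₁₃ d₂₄ })
         (λ { _ _ _ _ ((a₁ , a₂ , a₃ , a₄) , (_ , d₀₂ , _ , _ , d₁₃ , _)) →
              walk a₁ a₂ a₃ a₄ d₀₂ d₁₃ (d₀₂ ∘ sym) })
  where
  open Fold f
  c′ : EdgeColouring G _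
  c′ u v = c (map u) (map v)
  walk : ∀ {v₀ v₁ v₂ v₃ v₄} →
    Adj G v₀ v₁ → Adj G v₁ v₂ → Adj G v₂ v₃ → Adj G v₃ v₄ →
    v₀ ≢ v₂ → v₁ ≢ v₃ → v₂ ≢ v₄ →
    ¬ Alternating (c′ v₀ v₁) (c′ v₁ v₂) (c′ v₂ v₃) (c′ v₃ v₄)
  walk a₁ a₂ a₃ a₄ d₀₂ d₁₃ d₂₄ =
    noWalk _ _ (preservesAdj a₁) _ (preservesAdj a₂) (separates₂ a₁ a₂ d₀₂)
           _ (preservesAdj a₃) (separates₂ a₂ a₃ d₁₃)
           _ (preservesAdj a₄) (separates₂ a₃ a₄ d₂₄)

-- Products of folds are folds: a 2-path in G □ H either stays in one
-- factor or turns, and then its ends differ in both coordinates.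
_□ᶠ_ : ∀ {G G′ H H′} → Fold G G′ → Fold H H′ → Fold (G □ H) (G′ □ H′)
_□ᶠ_ {G} {G′} {H} {H′} f g = record
  { map = φ ; preservesAdj = adj ; separates₁ = sep₁ ; separates₂ = sep₂ }
  where
  module Φ = Fold f
  module Ψ = Fold g
  φ : V (G □ H) → V (G′ □ H′)
  φ (a , x) = Φ.map a , Ψ.map x
  adj : ∀ {u v} → Adj (G □ H) u v → Adj (G′ □ H′) (φ u) (φ v)
  adj (inj₁ (ab , refl)) = inj₁ (Φ.preservesAdj ab , refl)
  adj (inj₂ (xy , refl)) = inj₂ (Ψ.preservesAdj xy , refl)
  sep₁ : ∀ {u v} → Adj (G □ H) u v → φ u ≢ φ v
  sep₁ (inj₁ (ab , refl)) = Φ.separates₁ ab ∘ proj₁ ∘ ,-injective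
  sep₁ (inj₂ (xy , refl)) = Ψ.separates₁ xy ∘ proj₂ ∘ ,-injective
  sep₂ : ∀ {u v w} → Adj (G □ H) u v → Adj (G □ H) v w → u ≢ w → φ u ≢ φ w
  sep₂ (inj₁ (ab , refl)) (inj₁ (bc , refl)) u≢w =
    Φ.separates₂ ab bc (λ { refl → u≢w refl }) ∘ proj₁ ∘ ,-injective
  sep₂ (inj₁ (ab , refl)) (inj₂ (_  , refl)) _ = Φ.separates₁ ab ∘ proj₁ ∘ ,-injective
  sep₂ (inj₂ (xy , refl)) (inj₁ (_  , refl)) _ = Ψ.separates₁ xy ∘ proj₂ ∘ ,-injective
  sep₂ (inj₂ (xy , refl)) (inj₂ (yz , refl)) u≢w =
    Ψ.separates₂ xy yz (λ { refl → u≢w refl }) ∘ proj₂ ∘ ,-injective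

pathFold : ∀ m → Fold (P m) (P m)
pathFold m = record
  { map = λ i → i ; preservesAdj = λ ij → ij ; separates₁ = loopless
  ; separates₂ = λ _ _ i≢k → i≢k }
  where
  loopless : ∀ {i j} → Adj (P m) i j → i ≢ j
  loopless (inj₁ e) refl = 1+n≢n e
  loopless (inj₂ e) refl = 1+n≢n e

next : ∀ {q} .{{_ : NonZero q}} → Fin q → Fin q
next {q} x = suc (toℕ x) mod q

C : (q : ℕ) .{{_ : NonZero q}} → Graph
V (C q) = Fin q
Adj (C q) x y = next x ≡ y ⊎ next y ≡ x

NoShortCycle : (q : ℕ) .{{_ : NonZero q}} → Set
NoShortCycle q = ∀ x → next {q} x ≢ x × next (next x) ≢ x

noShortCycle? : ∀ q .{{_ : NonZero q}} → Dec (NoShortCycle q)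
noShortCycle? q = all? λ x → ¬? (next x ≟ᶠ x) ×-dec ¬? (next (next x) ≟ᶠ x)

wind : ∀ q .{{_ : NonZero q}} → NoShortCycle q → ∀ m → Fold (P m) (C q)
wind q noShort m = record
  { map = position ∘ toℕ ; preservesAdj = adj ; separates₁ = sep₁ ; separates₂ = sep₂ }
  where
  position : ℕ → Fin q
  position = fold (0 mod q) next
  adj : ∀ {i j} → Adj (P m) i j → Adj (C q) (position (toℕ i)) (position (toℕ j))
  adj (inj₁ e) = inj₁ (cong position e)
  adj (inj₂ e) = inj₂ (cong position e)
  sep₁ : ∀ {i j} → Adj (P m) i j → position (toℕ i) ≢ position (toℕ j)
  sep₁ (inj₁ e) eq = proj₁ (noShort _) (trans (cong position e) (sym eq))
  sep₁ (inj₂ e) eq = proj₁ (noShort _) (trans (cong position e) eq)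
  sep₂ : ∀ {i j l} → Adj (P m) i j → Adj (P m) j l → i ≢ l →
         position (toℕ i) ≢ position (toℕ l)
  sep₂ (inj₁ e₁) (inj₁ e₂) _ eq =
    proj₂ (noShort _) (trans (cong (next ∘ position) e₁) (trans (cong position e₂) (sym eq)))
  sep₂ (inj₂ e₁) (inj₂ e₂) _ eq =
    proj₂ (noShort _) (trans (cong (next ∘ position) e₂) (trans (cong position e₁) eq))
  sep₂ (inj₁ e₁) (inj₂ e₂) i≢l _ = i≢l (toℕ-injective (suc-injective (trans e₁ (sym e₂))))
  sep₂ (inj₂ e₁) (inj₁ e₂) i≢l _ = i≢l (toℕ-injective (trans (sym e₁) e₂))

record FiniteGraph (G : Graph) : Set₁ where
  field
    _≟_    : DecidableEquality (V G)
    every? : ∀ {Q : V G → Set} → (∀ u → Dec (Q u)) → Dec (∀ u → Q u)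
    adj?   : ∀ u v → Dec (Adj G u v)

finiteP : ∀ n → FiniteGraph (P n)
finiteP n = record
  { _≟_    = _≟ᶠ_
  ; every? = all?
  ; adj?   = λ i j → (suc (toℕ i) ≟ℕ toℕ j) ⊎-dec (suc (toℕ j) ≟ℕ toℕ i)
  }

finiteC : ∀ q .{{_ : NonZero q}} → FiniteGraph (C q)
finiteC q = record
  { _≟_    = _≟ᶠ_
  ; every? = all?
  ; adj?   = λ x y → (next x ≟ᶠ y) ⊎-dec (next y ≟ᶠ x)
  }

_□ᵈ_ : ∀ {G H} → FiniteGraph G → FiniteGraph H → FiniteGraph (G □ H)
_□ᵈ_ {G} {H} F D = record
  { _≟_    = ≡-dec F._≟_ D._≟_
  ; every? = λ Q? → map′ (λ h (a , x) → h a x) (λ h a x → h (a , x))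
                         (F.every? λ a → D.every? λ x → Q? (a , x))
  ; adj?   = λ (a , x) (b , y) → (F.adj? a b ×-dec D._≟_ x y) ⊎-dec (D.adj? x y ×-dec F._≟_ a b)
  }
  where
  module F = FiniteGraph F
  module D = FiniteGraph D

-- An edge uv of H together with its colour; a finite colouring is written
-- as a list of these, pairs not listed get colour 0.
record ColouredEdge (H : Graph) (k : ℕ) : Set where
  constructor _─_↦_
  field
    from to : V H
    colour  : Fin k

infix 6 _─_↦_

module _ {H : Graph} (F : FiniteGraph H) where
  open FiniteGraph F

  listColouring : ∀ {k} → List (ColouredEdge H (suc k)) → EdgeColouring H (suc k)
  listColouring []                   u v = 0F
  listColouring ((a ─ b ↦ x) ∷ rest) u v =
    if does ((a ≟ u ×-dec b ≟ v) ⊎-dec (a ≟ v ×-dec b ≟ u)) then x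
    else listColouring rest u v

  walkStar? : ∀ {k} (c : EdgeColouring H k) → Dec (IsWalkStar H c)
  walkStar? c = symmetric? ×-dec proper? ×-dec noWalk?
    where
    symmetric? : Dec (Symmetric H c)
    symmetric? = every? λ u → every? λ v → adj? u v →-dec (c u v ≟ᶠ c v u)
    proper? : Dec (ProperAlongWalks H c)
    proper? = every? λ u → every? λ v → adj? u v →-dec every? λ w → adj? v w →-dec
              ¬? (u ≟ w) →-dec ¬? (c u v ≟ᶠ c v w)
    noWalk? : Dec (NoAlternatingWalk H c)
    noWalk? =
      every? λ v₀ → every? λ v₁ → adj? v₀ v₁ →-dec
      every? λ v₂ → adj? v₁ v₂ →-dec ¬? (v₀ ≟ v₂) →-dec
      every? λ v₃ → adj? v₂ v₃ →-dec ¬? (v₁ ≟ v₃) →-dec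
      every? λ v₄ → adj? v₃ v₄ →-dec ¬? (v₂ ≟ v₄) →-dec
      ¬? ((c v₀ v₁ ≟ᶠ c v₂ v₃) ×-dec (c v₁ v₂ ≟ᶠ c v₃ v₄))

foldColouring : ∀ {G H k} → Fold G H → (F : FiniteGraph H) →
  (es : List (ColouredEdge H (suc k))) → True (walkStar? F (listColouring F es)) →
  StarColourable G (suc k)
foldColouring f F es ok = pullback f (listColouring F es) (toWitness ok)

transpose-injective : ∀ {n} (i j : Fin n) {x y} → transpose i j x ≡ transpose i j y → x ≡ y
transpose-injective i j {x} {y} eq = begin
  x                               ≡⟨ transpose-inverse j i ⟨
  transpose j i (transpose i j x) ≡⟨ cong (transpose j i) eq ⟩
  transpose j i (transpose i j y) ≡⟨ transpose-inverse j i ⟩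
  y                               ∎
  where open ≡-Reasoning

transpose-moves : ∀ {n} (i j : Fin n) → transpose i j i ≡ j
transpose-moves i j with i ≟ᶠ i
... | yes _   = refl
... | no  i≢i = ⊥-elim (i≢i refl)

transpose-fixes : ∀ {n} (i j x : Fin n) → x ≢ i → x ≢ j → transpose i j x ≡ x
transpose-fixes i j x x≢i x≢j with x ≟ᶠ i
... | yes x≡i = ⊥-elim (x≢i x≡i)
... | no  _   with x ≟ᶠ j
...   | yes x≡j = ⊥-elim (x≢j x≡j)
...   | no  _   = refl

-- Symmetry breaking: after renaming colours, any star colouring gives a
-- chosen 2-path uvw the colours 0 and 1.
normalise : ∀ {G k u v w} → Adj G u v → Adj G v w → u ≢ w →
  StarColourable G (suc (suc k)) →
  Σ (EdgeColouring G (suc (suc k))) λ c →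
    IsStarEdgeColouring G c × c u v ≡ 0F × c v w ≡ 1F
normalise {G} {k} {u} {v} {w} uv vw u≢w (c , star) =
  c₂ , star₂ , uv↦0 , vw↦1
  where
  σ₁ σ₂ : Fin (suc (suc k)) → Fin (suc (suc k))
  c₁ c₂ : EdgeColouring G (suc (suc k))
  σ₁ = transpose (c u v) 0F
  c₁ x y = σ₁ (c x y)
  σ₂ = transpose (c₁ v w) 1F
  c₂ x y = σ₂ (c₁ x y)
  star₁ : IsStarEdgeColouring G c₁
  star₁ = recolour σ₁ (transpose-injective _ _) c star
  star₂ : IsStarEdgeColouring G c₂
  star₂ = recolour σ₂ (transpose-injective _ _) c₁ star₁
  uv↦0₁ : c₁ u v ≡ 0F
  uv↦0₁ = transpose-moves (c u v) 0F
  uv↦0 : c₂ u v ≡ 0F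
  uv↦0 = trans (cong σ₂ uv↦0₁)
    (transpose-fixes _ _ _ (λ 0≡vw → proj₁ (proj₂ star₁) u v w uv vw u≢w (trans uv↦0₁ 0≡vw))
                           (λ ()))
  vw↦1 : c₂ v w ≡ 1F
  vw↦1 = transpose-moves (c₁ v w) 1F

-- Patterns a star colouring must avoid: two edges uv, vw of equal colour,
-- and a path or 4-cycle v₀ … v₄ (closed when v₄ = v₀) coloured a b a b.
data Pattern (A : Set) : Set where
  sameColour  : A → A → A → Pattern A
  alternating : A → A → A → A → A → Pattern A

-- A certificate that G has no star colouring with k′ + 2 colours: an
-- enumeration of the e′ + 2 edges (the first two forming a 2-path), the
-- inverse lookup from vertex pairs to edge numbers, and for each later edge
-- t a bucket of patterns that become fully coloured once edge t is.
record Certificate {G : Graph} (F : FiniteGraph G) (k′ e′ : ℕ) : Set where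
  field
    edges   : Vec (V G × V G) (suc (suc e′))
    index   : V G → V G → Fin (suc (suc e′))
    buckets : Vec (List (Pattern (V G))) e′

module Refutation {G : Graph} {F : FiniteGraph G} {k′ e′ : ℕ}
                  (cert : Certificate F k′ e′) where
  open FiniteGraph F
  open Certificate cert

  k nE : ℕ
  k  = suc (suc k′)
  nE = suc (suc e′)

  edge : Fin nE → V G × V G
  edge = lookup edges

  IndexConsistent : Set
  IndexConsistent = ∀ u v → Adj G u v → edge (index u v) ≡ (u , v) ⊎ edge (index u v) ≡ (v , u)

  Opening : V G × V G → V G × V G → Set
  Opening (u , v) (v′ , w) = v ≡ v′ × Adj G u v × Adj G v w × u ≢ w

  Genuine : Pattern (V G) → Set
  Genuine (sameColour u v w) = Adj G u v × Adj G v w × u ≢ w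
  Genuine (alternating v₀ v₁ v₂ v₃ v₄) =
    Path4 G v₀ v₁ v₂ v₃ v₄ ⊎ (v₄ ≡ v₀ × Cycle4 G v₀ v₁ v₂ v₃)

  edgesOf : Pattern (V G) → List (Fin nE)
  edgesOf (sameColour u v w) = index u v ∷ index v w ∷ []
  edgesOf (alternating v₀ v₁ v₂ v₃ v₄) =
    index v₀ v₁ ∷ index v₁ v₂ ∷ index v₂ v₃ ∷ index v₃ v₄ ∷ []

  Settled : ℕ → Pattern (V G) → Set
  Settled t pat = All (λ e → toℕ e ≤ t) (edgesOf pat)

  -- Bucket t holds genuine patterns settled by edge t (buckets start at edge 2).
  Placed : ∀ {r} → ℕ → Vec (List (Pattern (V G))) r → Set
  Placed t []         = ⊤
  Placed t (b ∷ rest) = All (λ pat → Genuine pat × Settled t pat) b × Placed (suc t) rest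

  Valid : Set
  Valid = IndexConsistent × Opening (edge 0F) (edge 1F) × Placed 2 buckets

  valid? : Dec Valid
  valid? = consistent? ×-dec opening? (edge 0F) (edge 1F) ×-dec placed? 2 buckets
    where
    _≢?_ : ∀ u v → Dec (u ≢ v)
    u ≢? v = ¬? (u ≟ v)
    consistent? : Dec IndexConsistent
    consistent? = every? λ u → every? λ v → adj? u v →-dec
      (≡-dec _≟_ _≟_ (edge (index u v)) (u , v) ⊎-dec ≡-dec _≟_ _≟_ (edge (index u v)) (v , u))
    opening? : ∀ e₀ e₁ → Dec (Opening e₀ e₁)
    opening? (u , v) (v′ , w) = v ≟ v′ ×-dec adj? u v ×-dec adj? v w ×-dec u ≢? w
    genuine? : ∀ pat → Dec (Genuine pat)
    genuine? (sameColour u v w) = adj? u v ×-dec adj? v w ×-dec u ≢? w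
    genuine? (alternating v₀ v₁ v₂ v₃ v₄) =
      ((adj? v₀ v₁ ×-dec adj? v₁ v₂ ×-dec adj? v₂ v₃ ×-dec adj? v₃ v₄) ×-dec
       (v₀ ≢? v₁ ×-dec v₀ ≢? v₂ ×-dec v₀ ≢? v₃ ×-dec v₀ ≢? v₄ ×-dec v₁ ≢? v₂ ×-dec
        v₁ ≢? v₃ ×-dec v₁ ≢? v₄ ×-dec v₂ ≢? v₃ ×-dec v₂ ≢? v₄ ×-dec v₃ ≢? v₄))
      ⊎-dec
      (v₄ ≟ v₀ ×-dec
       (adj? v₀ v₁ ×-dec adj? v₁ v₂ ×-dec adj? v₂ v₃ ×-dec adj? v₃ v₀) ×-dec
       (v₀ ≢? v₁ ×-dec v₀ ≢? v₂ ×-dec v₀ ≢? v₃ ×-dec v₁ ≢? v₂ ×-dec v₁ ≢? v₃ ×-dec v₂ ≢? v₃))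
    placed? : ∀ {r} t (bs : Vec (List (Pattern (V G))) r) → Dec (Placed t bs)
    placed? t []         = yes tt
    placed? t (b ∷ rest) =
      All.all? (λ pat → genuine? pat ×-dec All.all? (λ e → toℕ e ≤? t) (edgesOf pat)) b
      ×-dec placed? (suc t) rest

  -- The search colours edges 2, 3, … in turn; a branch dies as soon as a
  -- pattern of the current bucket is violated.
  Partial : Set
  Partial = Fin nE → Fin k

  extend : ℕ → Fin k → Partial → Partial
  extend t x p e = if toℕ e ≡ᵇ t then x else p e

  Violated : Partial → Pattern (V G) → Set
  Violated p (sameColour u v w) = p (index u v) ≡ p (index v w)
  Violated p (alternating v₀ v₁ v₂ v₃ v₄) =
    Alternating (p (index v₀ v₁)) (p (index v₁ v₂)) (p (index v₂ v₃)) (p (index v₃ v₄))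

  violated? : ∀ p pat → Dec (Violated p pat)
  violated? p (sameColour u v w) = p (index u v) ≟ᶠ p (index v w)
  violated? p (alternating v₀ v₁ v₂ v₃ v₄) =
    p (index v₀ v₁) ≟ᶠ p (index v₂ v₃) ×-dec p (index v₁ v₂) ≟ᶠ p (index v₃ v₄)

  violates : Partial → Pattern (V G) → Bool
  violates p pat = isYes (violated? p pat)

  violation : ∀ {p} pat → T (violates p pat) → Violated p pat
  violation {p} pat = toWitness {a? = violated? p pat}

  -- refute bs t p: every way of colouring edges t, t+1, … extending p
  -- violates a pattern in the buckets bs; closed b bs t p x: so does every
  -- way in which edge t gets colour x.
  refute : ∀ {r} → Vec (List (Pattern (V G))) r → ℕ → Partial → Bool
  closed : ∀ {r} → List (Pattern (V G)) → Vec (List (Pattern (V G))) r → ℕ → Partial → Fin k → Bool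
  refute []         t p = false
  refute (b ∷ rest) t p = all (closed b rest t p) (allFin k)
  closed b rest t p x = any (violates (extend t x p)) b ∨ refute rest (suc t) (extend t x p)

  start : Partial
  start 0F          = 0F
  start (Fin.suc _) = 1F

  -- Soundness: the branch of the search given by the true colours of a star
  -- colouring c never violates a pattern, so the search cannot close it.
  module Soundness (c : EdgeColouring G k) (star : IsStarEdgeColouring G c)
                   (consistent : IndexConsistent) where

    colour : Fin nE → Fin k
    colour e = uncurry c (edge e)

    colour-index : ∀ {u v} → Adj G u v → c u v ≡ colour (index u v)
    colour-index {u} {v} uv with consistent u v uv
    ... | inj₁ eq = sym (cong (uncurry c) eq)
    ... | inj₂ eq = trans (proj₁ star u v uv) (sym (cong (uncurry c) eq))

    Agree : ℕ → Partial → Set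
    Agree t p = ∀ e → toℕ e < t → colour e ≡ p e

    extend-agrees : ∀ {t p} (t<nE : t < nE) → Agree t p →
                    Agree (suc t) (extend t (colour (fromℕ< t<nE)) p)
    extend-agrees {t} t<nE agree e e≤t with toℕ e ≡ᵇ t in eq
    ... | true  = cong colour (toℕ-injective
                    (trans (≡ᵇ⇒≡ _ _ (subst T (sym eq) tt)) (sym (toℕ-fromℕ< t<nE))))
    ... | false with m≤n⇒m<n∨m≡n (≤-pred e≤t)
    ...   | inj₁ e<t = agree e e<t
    ...   | inj₂ e≡t = ⊥-elim (subst T eq (≡⇒≡ᵇ _ _ e≡t))

    observe : ∀ {u v x} → Adj G u v → colour (index u v) ≡ x → c u v ≡ x
    observe uv agree = trans (colour-index uv) agree

    observedAlternation : ∀ {p : Partial} {v₀ v₁ v₂ v₃ v₄} →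
      Adj G v₀ v₁ → Adj G v₁ v₂ → Adj G v₂ v₃ → Adj G v₃ v₄ →
      All (λ e → colour e ≡ p e) (edgesOf (alternating v₀ v₁ v₂ v₃ v₄)) →
      Violated p (alternating v₀ v₁ v₂ v₃ v₄) →
      Alternating (c v₀ v₁) (c v₁ v₂) (c v₂ v₃) (c v₃ v₄)
    observedAlternation a₁ a₂ a₃ a₄ (o₁ ∷ o₂ ∷ o₃ ∷ o₄ ∷ []) (e₁ , e₂) =
        trans (observe a₁ o₁) (trans e₁ (sym (observe a₃ o₃)))
      , trans (observe a₂ o₂) (trans e₂ (sym (observe a₄ o₄)))

    notViolated : ∀ {p : Partial} pat → Genuine pat → All (λ e → colour e ≡ p e) (edgesOf pat) →
                  ¬ T (violates p pat)
    notViolated {p} pat@(sameColour u v w) (uv , vw , u≢w) (o₁ ∷ o₂ ∷ []) viol =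
      proj₁ (proj₂ star) u v w uv vw u≢w
        (trans (observe uv o₁) (trans (violation {p} pat viol) (sym (observe vw o₂))))
    notViolated {p} pat@(alternating _ _ _ _ _) (inj₁ path@((a₁ , a₂ , a₃ , a₄) , _)) obs viol =
      star⇒noAlternatingPath G c star _ _ _ _ _ path
        (observedAlternation a₁ a₂ a₃ a₄ obs (violation {p} pat viol))
    notViolated {p} pat@(alternating _ _ _ _ _)
                (inj₂ (refl , cycle@((a₁ , a₂ , a₃ , a₄) , _))) obs viol =
      star⇒noAlternatingCycle G c star _ _ _ _ cycle
        (observedAlternation a₁ a₂ a₃ a₄ obs (violation {p} pat viol))

    -- Following the colours of c, the search never closes a branch: at
    -- edge t take the branch of its true colour; no pattern of bucket t is
    -- violated there, and the later buckets are handled recursively.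
    refute-sound : ∀ {r} (bs : Vec (List (Pattern (V G))) r) t p →
      r + t ≡ nE → Placed t bs → Agree t p → ¬ T (refute bs t p)
    refute-sound []         t p _    _                        _     ()
    refute-sound (b ∷ rest) t p size (placedHere , placedRest) agree dead =
      [ noHit , refute-sound rest (suc t) p′ (trans (+-suc _ t) size) placedRest agree′ ]
        (Equivalence.to T-∨ (All.lookup (all⁺ (closed b rest t p) (allFin k) dead) (∈-allFin x)))
      where
      t<nE : t < nE
      t<nE = subst (t <_) size (s≤s (m≤n+m t _))
      x : Fin k
      x = colour (fromℕ< t<nE)
      p′ : Partial
      p′ = extend t x p
      agree′ : Agree (suc t) p′
      agree′ = extend-agrees t<nE agree
      noHit : ¬ T (any (violates p′) b)
      noHit hit = All.lookupWith
        (λ {pat} (genuine , settled) →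
           notViolated pat genuine (All.map (λ e≤t → agree′ _ (s≤s e≤t)) settled))
        placedHere (any⁻ _ b hit)

  normaliseOpening : ∀ e₀ e₁ → Opening e₀ e₁ → StarColourable G k →
    Σ (EdgeColouring G k) λ c →
      IsStarEdgeColouring G c × uncurry c e₀ ≡ 0F × uncurry c e₁ ≡ 1F
  normaliseOpening (u , v) (.v , w) (refl , uv , vw , u≢w) = normalise uv vw u≢w

  refutes : True valid? → T (refute buckets 2 start) → ¬ StarColourable G k
  refutes ok dead coloured with toWitness ok
  ... | consistent , opening , placed
    with normaliseOpening (edge 0F) (edge 1F) opening coloured
  ... | c , star , first↦0 , second↦1 =
    refute-sound buckets 2 start (+-comm e′ 2) placed agreeStart dead
    where
    open Soundness c star consistent
    agreeStart : Agree 2 start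
    agreeStart 0F                    _ = first↦0
    agreeStart 1F                    _ = second↦1
    agreeStart (Fin.suc (Fin.suc _)) (s≤s (s≤s ()))

finiteGrid : ∀ m n → FiniteGraph (Grid m n)
finiteGrid m n = finiteP m □ᵈ finiteP n


colouring22 : List (ColouredEdge (Grid 2 2) 3)
colouring22 =
  (0F , 0F) ─ (1F , 0F) ↦ 1F ∷ (0F , 1F) ─ (1F , 1F) ↦ 1F ∷ (0F , 0F) ─ (0F , 1F) ↦ 0F ∷
  (1F , 0F) ─ (1F , 1F) ↦ 2F ∷
  []

colouring33 : List (ColouredEdge (Grid 3 3) 5)
colouring33 =
  (0F , 0F) ─ (1F , 0F) ↦ 1F ∷ (0F , 1F) ─ (1F , 1F) ↦ 2F ∷ (0F , 2F) ─ (1F , 2F) ↦ 2F ∷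
  (1F , 0F) ─ (2F , 0F) ↦ 2F ∷ (1F , 1F) ─ (2F , 1F) ↦ 0F ∷ (1F , 2F) ─ (2F , 2F) ↦ 3F ∷
  (0F , 0F) ─ (0F , 1F) ↦ 0F ∷ (0F , 1F) ─ (0F , 2F) ↦ 1F ∷ (1F , 0F) ─ (1F , 1F) ↦ 3F ∷
  (1F , 1F) ─ (1F , 2F) ↦ 4F ∷ (2F , 0F) ─ (2F , 1F) ↦ 4F ∷ (2F , 1F) ─ (2F , 2F) ↦ 1F ∷
  []

colouring34 : List (ColouredEdge (Grid 3 4) 5)
colouring34 =
  (0F , 0F) ─ (1F , 0F) ↦ 1F ∷ (0F , 1F) ─ (1F , 1F) ↦ 2F ∷ (0F , 2F) ─ (1F , 2F) ↦ 3F ∷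
  (0F , 3F) ─ (1F , 3F) ↦ 0F ∷ (1F , 0F) ─ (2F , 0F) ↦ 2F ∷ (1F , 1F) ─ (2F , 1F) ↦ 0F ∷
  (1F , 2F) ─ (2F , 2F) ↦ 2F ∷ (1F , 3F) ─ (2F , 3F) ↦ 4F ∷ (0F , 0F) ─ (0F , 1F) ↦ 0F ∷
  (0F , 1F) ─ (0F , 2F) ↦ 1F ∷ (0F , 2F) ─ (0F , 3F) ↦ 2F ∷ (1F , 0F) ─ (1F , 1F) ↦ 3F ∷
  (1F , 1F) ─ (1F , 2F) ↦ 4F ∷ (1F , 2F) ─ (1F , 3F) ↦ 1F ∷ (2F , 0F) ─ (2F , 1F) ↦ 4F ∷
  (2F , 1F) ─ (2F , 2F) ↦ 1F ∷ (2F , 2F) ─ (2F , 3F) ↦ 0F ∷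
  []

-- P₂ □ C₄ with 4 colours; every ladder P₂ □ P_n folds onto it.
ladderColouring : List (ColouredEdge (P 2 □ C 4) 4)
ladderColouring =
  (0F , 0F) ─ (1F , 0F) ↦ 2F ∷ (0F , 1F) ─ (1F , 1F) ↦ 3F ∷ (0F , 2F) ─ (1F , 2F) ↦ 1F ∷
  (0F , 3F) ─ (1F , 3F) ↦ 0F ∷ (0F , 0F) ─ (0F , 1F) ↦ 0F ∷ (0F , 1F) ─ (0F , 2F) ↦ 2F ∷
  (0F , 2F) ─ (0F , 3F) ↦ 3F ∷ (0F , 3F) ─ (0F , 0F) ↦ 1F ∷ (1F , 0F) ─ (1F , 1F) ↦ 1F ∷
  (1F , 1F) ─ (1F , 2F) ↦ 0F ∷ (1F , 2F) ─ (1F , 3F) ↦ 2F ∷ (1F , 3F) ─ (1F , 0F) ↦ 3F ∷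
  []

-- C₃ □ C₃ with 6 colours; every grid folds onto it.
torusColouring : List (ColouredEdge (C 3 □ C 3) 6)
torusColouring =
  (0F , 0F) ─ (1F , 0F) ↦ 2F ∷ (0F , 1F) ─ (1F , 1F) ↦ 3F ∷ (0F , 2F) ─ (1F , 2F) ↦ 5F ∷
  (1F , 0F) ─ (2F , 0F) ↦ 5F ∷ (1F , 1F) ─ (2F , 1F) ↦ 2F ∷ (1F , 2F) ─ (2F , 2F) ↦ 3F ∷
  (2F , 0F) ─ (0F , 0F) ↦ 3F ∷ (2F , 1F) ─ (0F , 1F) ↦ 5F ∷ (2F , 2F) ─ (0F , 2F) ↦ 2F ∷
  (0F , 0F) ─ (0F , 1F) ↦ 0F ∷ (0F , 1F) ─ (0F , 2F) ↦ 4F ∷ (0F , 2F) ─ (0F , 0F) ↦ 1F ∷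
  (1F , 0F) ─ (1F , 1F) ↦ 4F ∷ (1F , 1F) ─ (1F , 2F) ↦ 1F ∷ (1F , 2F) ─ (1F , 0F) ↦ 0F ∷
  (2F , 0F) ─ (2F , 1F) ↦ 1F ∷ (2F , 1F) ─ (2F , 2F) ↦ 0F ∷ (2F , 2F) ─ (2F , 0F) ↦ 4F ∷
  []

wind₃ : ∀ m → Fold (P m) (C 3)
wind₃ = wind 3 (toWitness {a? = noShortCycle? 3} _)

wind₄ : ∀ m → Fold (P m) (C 4)
wind₄ = wind 4 (toWitness {a? = noShortCycle? 4} _)

grid22 : StarColourable (Grid 2 2) 3
grid22 = foldColouring (pathFold 2 □ᶠ pathFold 2) (finiteGrid 2 2) colouring22 _

grid33 : StarColourable (Grid 3 3) 5
grid33 = foldColouring (pathFold 3 □ᶠ pathFold 3) (finiteGrid 3 3) colouring33 _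

grid34 : StarColourable (Grid 3 4) 5
grid34 = foldColouring (pathFold 3 □ᶠ pathFold 4) (finiteGrid 3 4) colouring34 _

ladder : ∀ n → StarColourable (Grid 2 n) 4
ladder n = foldColouring (pathFold 2 □ᶠ wind₄ n) (finiteP 2 □ᵈ finiteC 4) ladderColouring _

torus : ∀ m n → StarColourable (Grid m n) 6
torus m n = foldColouring (wind₃ m □ᶠ wind₃ n) (finiteC 3 □ᵈ finiteC 3) torusColouring _

-- Edge numbers on P_m □ P_n from two tables: across x y numbers the edge
-- (x,y)(x+1,y) and along x y the edge (x,y)(x,y+1).  Only adjacent pairs
-- are ever looked up, so the direction of an edge determines the entry.
gridIndex : ∀ {m n e} → (across along : Vec (Vec (Fin e) n) m) →
            V (Grid m n) → V (Grid m n) → Fin e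
gridIndex across along (x , y) (x′ , y′) =
  if      suc (toℕ x)  ≡ᵇ toℕ x′ then lookup (lookup across x) y
  else if suc (toℕ x′) ≡ᵇ toℕ x  then lookup (lookup across x′) y
  else if suc (toℕ y)  ≡ᵇ toℕ y′ then lookup (lookup along x) y
  else                                 lookup (lookup along x) y′

across22 along22 : Vec (Vec (Fin 4) 2) 2
across22 =
  (# 0 ∷ # 2 ∷ []) ∷
  (# 0 ∷ # 0 ∷ []) ∷ []
along22 =
  (# 1 ∷ # 0 ∷ []) ∷
  (# 3 ∷ # 0 ∷ []) ∷ []
certificate22 : Certificate (finiteGrid 2 2) 0 2
certificate22 = record
  { edges =
      ((1F , 0F) , (0F , 0F)) ∷ ((0F , 0F) , (0F , 1F)) ∷ ((0F , 1F) , (1F , 1F)) ∷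
      ((1F , 0F) , (1F , 1F)) ∷ []
  ; index = gridIndex across22 along22
  ; buckets =
    (sameColour (0F , 0F) (0F , 1F) (1F , 1F) ∷ []) ∷
    (sameColour (0F , 0F) (1F , 0F) (1F , 1F) ∷
     alternating (0F , 0F) (1F , 0F) (1F , 1F) (0F , 1F) (0F , 0F) ∷
     sameColour (0F , 1F) (1F , 1F) (1F , 0F) ∷ []) ∷ []
  }

across23 along23 : Vec (Vec (Fin 7) 3) 2
across23 =
  (# 3 ∷ # 0 ∷ # 4 ∷ []) ∷
  (# 0 ∷ # 0 ∷ # 0 ∷ []) ∷ []
along23 =
  (# 2 ∷ # 1 ∷ # 0 ∷ []) ∷
  (# 5 ∷ # 6 ∷ # 0 ∷ []) ∷ []
certificate23 : Certificate (finiteGrid 2 3) 1 5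
certificate23 = record
  { edges =
      ((1F , 1F) , (0F , 1F)) ∷ ((0F , 1F) , (0F , 2F)) ∷ ((0F , 0F) , (0F , 1F)) ∷
      ((0F , 0F) , (1F , 0F)) ∷ ((0F , 2F) , (1F , 2F)) ∷ ((1F , 0F) , (1F , 1F)) ∷
      ((1F , 1F) , (1F , 2F)) ∷ []
  ; index = gridIndex across23 along23
  ; buckets =
    (sameColour (0F , 0F) (0F , 1F) (1F , 1F) ∷ sameColour (0F , 0F) (0F , 1F) (0F , 2F) ∷ []) ∷
    (sameColour (0F , 1F) (0F , 0F) (1F , 0F) ∷ []) ∷
    (sameColour (0F , 1F) (0F , 2F) (1F , 2F) ∷
     alternating (1F , 0F) (0F , 0F) (0F , 1F) (0F , 2F) (1F , 2F) ∷ []) ∷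
    (sameColour (0F , 0F) (1F , 0F) (1F , 1F) ∷
     alternating (0F , 0F) (1F , 0F) (1F , 1F) (0F , 1F) (0F , 2F) ∷
     alternating (0F , 0F) (1F , 0F) (1F , 1F) (0F , 1F) (0F , 0F) ∷
     sameColour (0F , 1F) (1F , 1F) (1F , 0F) ∷
     alternating (0F , 2F) (0F , 1F) (0F , 0F) (1F , 0F) (1F , 1F) ∷
     alternating (1F , 0F) (1F , 1F) (0F , 1F) (0F , 2F) (1F , 2F) ∷ []) ∷
    (alternating (0F , 0F) (1F , 0F) (1F , 1F) (1F , 2F) (0F , 2F) ∷
     alternating (0F , 0F) (0F , 1F) (1F , 1F) (1F , 2F) (0F , 2F) ∷
     alternating (0F , 0F) (0F , 1F) (0F , 2F) (1F , 2F) (1F , 1F) ∷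
     sameColour (0F , 1F) (1F , 1F) (1F , 2F) ∷
     alternating (0F , 1F) (1F , 1F) (1F , 2F) (0F , 2F) (0F , 1F) ∷
     alternating (0F , 1F) (0F , 2F) (1F , 2F) (1F , 1F) (1F , 0F) ∷
     alternating (0F , 1F) (0F , 0F) (1F , 0F) (1F , 1F) (1F , 2F) ∷
     sameColour (0F , 2F) (1F , 2F) (1F , 1F) ∷
     alternating (1F , 0F) (0F , 0F) (0F , 1F) (1F , 1F) (1F , 2F) ∷
     sameColour (1F , 0F) (1F , 1F) (1F , 2F) ∷ []) ∷ []
  }

across33 along33 : Vec (Vec (Fin 12) 3) 3
across33 =
  (# 5 ∷ # 1 ∷ # 7 ∷ []) ∷
  (# 8 ∷ # 0 ∷ # 9 ∷ []) ∷
  (# 0 ∷ # 0 ∷ # 0 ∷ []) ∷ []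
along33 =
  (# 4 ∷ # 6 ∷ # 0 ∷ []) ∷
  (# 2 ∷ # 3 ∷ # 0 ∷ []) ∷
  (# 10 ∷ # 11 ∷ # 0 ∷ []) ∷ []
certificate33 : Certificate (finiteGrid 3 3) 2 10
certificate33 = record
  { edges =
      ((2F , 1F) , (1F , 1F)) ∷ ((1F , 1F) , (0F , 1F)) ∷ ((1F , 0F) , (1F , 1F)) ∷
      ((1F , 1F) , (1F , 2F)) ∷ ((0F , 0F) , (0F , 1F)) ∷ ((0F , 0F) , (1F , 0F)) ∷
      ((0F , 1F) , (0F , 2F)) ∷ ((0F , 2F) , (1F , 2F)) ∷ ((1F , 0F) , (2F , 0F)) ∷
      ((1F , 2F) , (2F , 2F)) ∷ ((2F , 0F) , (2F , 1F)) ∷ ((2F , 1F) , (2F , 2F)) ∷ []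
  ; index = gridIndex across33 along33
  ; buckets =
    (sameColour (0F , 1F) (1F , 1F) (1F , 0F) ∷ sameColour (1F , 0F) (1F , 1F) (2F , 1F) ∷ []) ∷
    (sameColour (0F , 1F) (1F , 1F) (1F , 2F) ∷ sameColour (1F , 0F) (1F , 1F) (1F , 2F) ∷
     sameColour (1F , 2F) (1F , 1F) (2F , 1F) ∷ []) ∷
    (sameColour (0F , 0F) (0F , 1F) (1F , 1F) ∷ []) ∷
    (sameColour (0F , 0F) (1F , 0F) (1F , 1F) ∷
     alternating (0F , 0F) (1F , 0F) (1F , 1F) (0F , 1F) (0F , 0F) ∷
     sameColour (0F , 1F) (0F , 0F) (1F , 0F) ∷
     alternating (0F , 1F) (0F , 0F) (1F , 0F) (1F , 1F) (2F , 1F) ∷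
     alternating (0F , 1F) (0F , 0F) (1F , 0F) (1F , 1F) (1F , 2F) ∷
     alternating (1F , 0F) (0F , 0F) (0F , 1F) (1F , 1F) (2F , 1F) ∷
     alternating (1F , 0F) (0F , 0F) (0F , 1F) (1F , 1F) (1F , 2F) ∷ []) ∷
    (alternating (0F , 0F) (1F , 0F) (1F , 1F) (0F , 1F) (0F , 2F) ∷
     sameColour (0F , 0F) (0F , 1F) (0F , 2F) ∷ sameColour (0F , 2F) (0F , 1F) (1F , 1F) ∷
     alternating (0F , 2F) (0F , 1F) (0F , 0F) (1F , 0F) (1F , 1F) ∷ []) ∷
    (alternating (0F , 0F) (1F , 0F) (1F , 1F) (1F , 2F) (0F , 2F) ∷
     alternating (0F , 0F) (0F , 1F) (1F , 1F) (1F , 2F) (0F , 2F) ∷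
     alternating (0F , 0F) (0F , 1F) (0F , 2F) (1F , 2F) (1F , 1F) ∷
     alternating (0F , 1F) (1F , 1F) (1F , 2F) (0F , 2F) (0F , 1F) ∷
     sameColour (0F , 1F) (0F , 2F) (1F , 2F) ∷
     alternating (0F , 1F) (0F , 2F) (1F , 2F) (1F , 1F) (2F , 1F) ∷
     alternating (0F , 1F) (0F , 2F) (1F , 2F) (1F , 1F) (1F , 0F) ∷
     sameColour (0F , 2F) (1F , 2F) (1F , 1F) ∷
     alternating (1F , 0F) (0F , 0F) (0F , 1F) (0F , 2F) (1F , 2F) ∷
     alternating (1F , 0F) (1F , 1F) (0F , 1F) (0F , 2F) (1F , 2F) ∷
     alternating (1F , 2F) (0F , 2F) (0F , 1F) (1F , 1F) (2F , 1F) ∷ []) ∷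
    (sameColour (0F , 0F) (1F , 0F) (2F , 0F) ∷
     alternating (0F , 0F) (0F , 1F) (1F , 1F) (1F , 0F) (2F , 0F) ∷
     alternating (0F , 2F) (1F , 2F) (1F , 1F) (1F , 0F) (2F , 0F) ∷
     alternating (0F , 2F) (0F , 1F) (1F , 1F) (1F , 0F) (2F , 0F) ∷
     alternating (0F , 2F) (0F , 1F) (0F , 0F) (1F , 0F) (2F , 0F) ∷
     alternating (1F , 1F) (0F , 1F) (0F , 0F) (1F , 0F) (2F , 0F) ∷
     sameColour (1F , 1F) (1F , 0F) (2F , 0F) ∷ []) ∷
    (alternating (0F , 0F) (1F , 0F) (1F , 1F) (1F , 2F) (2F , 2F) ∷
     alternating (0F , 0F) (0F , 1F) (1F , 1F) (1F , 2F) (2F , 2F) ∷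
     alternating (0F , 0F) (0F , 1F) (0F , 2F) (1F , 2F) (2F , 2F) ∷
     sameColour (0F , 2F) (1F , 2F) (2F , 2F) ∷
     alternating (0F , 2F) (0F , 1F) (1F , 1F) (1F , 2F) (2F , 2F) ∷
     alternating (1F , 1F) (0F , 1F) (0F , 2F) (1F , 2F) (2F , 2F) ∷
     sameColour (1F , 1F) (1F , 2F) (2F , 2F) ∷
     alternating (2F , 0F) (1F , 0F) (1F , 1F) (1F , 2F) (2F , 2F) ∷ []) ∷
    (alternating (0F , 0F) (1F , 0F) (2F , 0F) (2F , 1F) (1F , 1F) ∷
     alternating (0F , 0F) (1F , 0F) (1F , 1F) (2F , 1F) (2F , 0F) ∷
     alternating (0F , 0F) (0F , 1F) (1F , 1F) (2F , 1F) (2F , 0F) ∷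
     alternating (0F , 1F) (1F , 1F) (2F , 1F) (2F , 0F) (1F , 0F) ∷
     alternating (0F , 1F) (1F , 1F) (1F , 0F) (2F , 0F) (2F , 1F) ∷
     alternating (0F , 1F) (0F , 0F) (1F , 0F) (2F , 0F) (2F , 1F) ∷
     alternating (0F , 2F) (1F , 2F) (1F , 1F) (2F , 1F) (2F , 0F) ∷
     alternating (0F , 2F) (0F , 1F) (1F , 1F) (2F , 1F) (2F , 0F) ∷
     sameColour (1F , 0F) (2F , 0F) (2F , 1F) ∷
     alternating (1F , 0F) (2F , 0F) (2F , 1F) (1F , 1F) (1F , 2F) ∷
     alternating (1F , 0F) (2F , 0F) (2F , 1F) (1F , 1F) (1F , 0F) ∷
     sameColour (1F , 1F) (2F , 1F) (2F , 0F) ∷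
     alternating (1F , 2F) (1F , 1F) (1F , 0F) (2F , 0F) (2F , 1F) ∷
     alternating (2F , 0F) (2F , 1F) (1F , 1F) (1F , 2F) (2F , 2F) ∷ []) ∷
    (alternating (0F , 0F) (1F , 0F) (2F , 0F) (2F , 1F) (2F , 2F) ∷
     alternating (0F , 0F) (1F , 0F) (1F , 1F) (2F , 1F) (2F , 2F) ∷
     alternating (0F , 0F) (0F , 1F) (1F , 1F) (2F , 1F) (2F , 2F) ∷
     alternating (0F , 1F) (1F , 1F) (2F , 1F) (2F , 2F) (1F , 2F) ∷
     alternating (0F , 1F) (1F , 1F) (1F , 2F) (2F , 2F) (2F , 1F) ∷
     alternating (0F , 1F) (0F , 2F) (1F , 2F) (2F , 2F) (2F , 1F) ∷
     alternating (0F , 2F) (1F , 2F) (2F , 2F) (2F , 1F) (1F , 1F) ∷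
     alternating (0F , 2F) (1F , 2F) (2F , 2F) (2F , 1F) (2F , 0F) ∷
     alternating (0F , 2F) (1F , 2F) (1F , 1F) (2F , 1F) (2F , 2F) ∷
     alternating (0F , 2F) (0F , 1F) (1F , 1F) (2F , 1F) (2F , 2F) ∷
     alternating (1F , 0F) (2F , 0F) (2F , 1F) (2F , 2F) (1F , 2F) ∷
     alternating (1F , 0F) (1F , 1F) (2F , 1F) (2F , 2F) (1F , 2F) ∷
     alternating (1F , 0F) (1F , 1F) (1F , 2F) (2F , 2F) (2F , 1F) ∷
     sameColour (1F , 1F) (2F , 1F) (2F , 2F) ∷
     alternating (1F , 1F) (2F , 1F) (2F , 2F) (1F , 2F) (1F , 1F) ∷
     alternating (1F , 1F) (1F , 2F) (2F , 2F) (2F , 1F) (2F , 0F) ∷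
     alternating (1F , 1F) (1F , 0F) (2F , 0F) (2F , 1F) (2F , 2F) ∷
     sameColour (1F , 2F) (2F , 2F) (2F , 1F) ∷
     alternating (2F , 0F) (1F , 0F) (1F , 1F) (2F , 1F) (2F , 2F) ∷
     sameColour (2F , 0F) (2F , 1F) (2F , 2F) ∷ []) ∷ []
  }

across35 along35 : Vec (Vec (Fin 22) 5) 3
across35 =
  (# 15 ∷ # 5 ∷ # 1 ∷ # 7 ∷ # 17 ∷ []) ∷
  (# 18 ∷ # 9 ∷ # 0 ∷ # 11 ∷ # 19 ∷ []) ∷
  (# 0 ∷ # 0 ∷ # 0 ∷ # 0 ∷ # 0 ∷ []) ∷ []
along35 =
  (# 14 ∷ # 4 ∷ # 6 ∷ # 16 ∷ # 0 ∷ []) ∷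
  (# 8 ∷ # 2 ∷ # 3 ∷ # 10 ∷ # 0 ∷ []) ∷
  (# 20 ∷ # 12 ∷ # 13 ∷ # 21 ∷ # 0 ∷ []) ∷ []
certificate35 : Certificate (finiteGrid 3 5) 3 20
certificate35 = record
  { edges =
      ((2F , 2F) , (1F , 2F)) ∷ ((1F , 2F) , (0F , 2F)) ∷ ((1F , 1F) , (1F , 2F)) ∷
      ((1F , 2F) , (1F , 3F)) ∷ ((0F , 1F) , (0F , 2F)) ∷ ((0F , 1F) , (1F , 1F)) ∷
      ((0F , 2F) , (0F , 3F)) ∷ ((0F , 3F) , (1F , 3F)) ∷ ((1F , 0F) , (1F , 1F)) ∷
      ((1F , 1F) , (2F , 1F)) ∷ ((1F , 3F) , (1F , 4F)) ∷ ((1F , 3F) , (2F , 3F)) ∷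
      ((2F , 1F) , (2F , 2F)) ∷ ((2F , 2F) , (2F , 3F)) ∷ ((0F , 0F) , (0F , 1F)) ∷
      ((0F , 0F) , (1F , 0F)) ∷ ((0F , 3F) , (0F , 4F)) ∷ ((0F , 4F) , (1F , 4F)) ∷
      ((1F , 0F) , (2F , 0F)) ∷ ((1F , 4F) , (2F , 4F)) ∷ ((2F , 0F) , (2F , 1F)) ∷
      ((2F , 3F) , (2F , 4F)) ∷ []
  ; index = gridIndex across35 along35
  ; buckets =
    (sameColour (0F , 2F) (1F , 2F) (1F , 1F) ∷ sameColour (1F , 1F) (1F , 2F) (2F , 2F) ∷ []) ∷
    (sameColour (0F , 2F) (1F , 2F) (1F , 3F) ∷ sameColour (1F , 1F) (1F , 2F) (1F , 3F) ∷
     sameColour (1F , 3F) (1F , 2F) (2F , 2F) ∷ []) ∷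
    (sameColour (0F , 1F) (0F , 2F) (1F , 2F) ∷ []) ∷
    (sameColour (0F , 1F) (1F , 1F) (1F , 2F) ∷
     alternating (0F , 1F) (1F , 1F) (1F , 2F) (0F , 2F) (0F , 1F) ∷
     sameColour (0F , 2F) (0F , 1F) (1F , 1F) ∷
     alternating (0F , 2F) (0F , 1F) (1F , 1F) (1F , 2F) (2F , 2F) ∷
     alternating (0F , 2F) (0F , 1F) (1F , 1F) (1F , 2F) (1F , 3F) ∷
     alternating (1F , 1F) (0F , 1F) (0F , 2F) (1F , 2F) (2F , 2F) ∷
     alternating (1F , 1F) (0F , 1F) (0F , 2F) (1F , 2F) (1F , 3F) ∷ []) ∷
    (alternating (0F , 1F) (1F , 1F) (1F , 2F) (0F , 2F) (0F , 3F) ∷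
     sameColour (0F , 1F) (0F , 2F) (0F , 3F) ∷ sameColour (0F , 3F) (0F , 2F) (1F , 2F) ∷
     alternating (0F , 3F) (0F , 2F) (0F , 1F) (1F , 1F) (1F , 2F) ∷ []) ∷
    (alternating (0F , 1F) (1F , 1F) (1F , 2F) (1F , 3F) (0F , 3F) ∷
     alternating (0F , 1F) (0F , 2F) (1F , 2F) (1F , 3F) (0F , 3F) ∷
     alternating (0F , 1F) (0F , 2F) (0F , 3F) (1F , 3F) (1F , 2F) ∷
     alternating (0F , 2F) (1F , 2F) (1F , 3F) (0F , 3F) (0F , 2F) ∷
     sameColour (0F , 2F) (0F , 3F) (1F , 3F) ∷
     alternating (0F , 2F) (0F , 3F) (1F , 3F) (1F , 2F) (2F , 2F) ∷
     alternating (0F , 2F) (0F , 3F) (1F , 3F) (1F , 2F) (1F , 1F) ∷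
     sameColour (0F , 3F) (1F , 3F) (1F , 2F) ∷
     alternating (1F , 1F) (0F , 1F) (0F , 2F) (0F , 3F) (1F , 3F) ∷
     alternating (1F , 1F) (1F , 2F) (0F , 2F) (0F , 3F) (1F , 3F) ∷
     alternating (1F , 3F) (0F , 3F) (0F , 2F) (1F , 2F) (2F , 2F) ∷ []) ∷
    (sameColour (0F , 1F) (1F , 1F) (1F , 0F) ∷
     alternating (0F , 1F) (0F , 2F) (1F , 2F) (1F , 1F) (1F , 0F) ∷
     alternating (0F , 3F) (1F , 3F) (1F , 2F) (1F , 1F) (1F , 0F) ∷
     alternating (0F , 3F) (0F , 2F) (1F , 2F) (1F , 1F) (1F , 0F) ∷
     alternating (0F , 3F) (0F , 2F) (0F , 1F) (1F , 1F) (1F , 0F) ∷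
     alternating (1F , 0F) (1F , 1F) (0F , 1F) (0F , 2F) (1F , 2F) ∷
     sameColour (1F , 0F) (1F , 1F) (1F , 2F) ∷ []) ∷
    (sameColour (0F , 1F) (1F , 1F) (2F , 1F) ∷
     alternating (0F , 1F) (0F , 2F) (1F , 2F) (1F , 1F) (2F , 1F) ∷
     alternating (0F , 3F) (1F , 3F) (1F , 2F) (1F , 1F) (2F , 1F) ∷
     alternating (0F , 3F) (0F , 2F) (1F , 2F) (1F , 1F) (2F , 1F) ∷
     alternating (0F , 3F) (0F , 2F) (0F , 1F) (1F , 1F) (2F , 1F) ∷
     sameColour (1F , 0F) (1F , 1F) (2F , 1F) ∷
     alternating (1F , 2F) (0F , 2F) (0F , 1F) (1F , 1F) (2F , 1F) ∷
     sameColour (1F , 2F) (1F , 1F) (2F , 1F) ∷ []) ∷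
    (alternating (0F , 1F) (1F , 1F) (1F , 2F) (1F , 3F) (1F , 4F) ∷
     alternating (0F , 1F) (0F , 2F) (1F , 2F) (1F , 3F) (1F , 4F) ∷
     alternating (0F , 1F) (0F , 2F) (0F , 3F) (1F , 3F) (1F , 4F) ∷
     sameColour (0F , 3F) (1F , 3F) (1F , 4F) ∷
     alternating (0F , 3F) (0F , 2F) (1F , 2F) (1F , 3F) (1F , 4F) ∷
     alternating (1F , 0F) (1F , 1F) (1F , 2F) (1F , 3F) (1F , 4F) ∷
     alternating (1F , 2F) (0F , 2F) (0F , 3F) (1F , 3F) (1F , 4F) ∷
     sameColour (1F , 2F) (1F , 3F) (1F , 4F) ∷
     alternating (1F , 4F) (1F , 3F) (1F , 2F) (1F , 1F) (2F , 1F) ∷ []) ∷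
    (alternating (0F , 1F) (1F , 1F) (1F , 2F) (1F , 3F) (2F , 3F) ∷
     alternating (0F , 1F) (0F , 2F) (1F , 2F) (1F , 3F) (2F , 3F) ∷
     alternating (0F , 1F) (0F , 2F) (0F , 3F) (1F , 3F) (2F , 3F) ∷
     sameColour (0F , 3F) (1F , 3F) (2F , 3F) ∷
     alternating (0F , 3F) (0F , 2F) (1F , 2F) (1F , 3F) (2F , 3F) ∷
     alternating (1F , 0F) (1F , 1F) (1F , 2F) (1F , 3F) (2F , 3F) ∷
     alternating (1F , 2F) (0F , 2F) (0F , 3F) (1F , 3F) (2F , 3F) ∷
     sameColour (1F , 2F) (1F , 3F) (2F , 3F) ∷ sameColour (1F , 4F) (1F , 3F) (2F , 3F) ∷
     alternating (2F , 1F) (1F , 1F) (1F , 2F) (1F , 3F) (2F , 3F) ∷ []) ∷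
    (alternating (0F , 1F) (1F , 1F) (2F , 1F) (2F , 2F) (1F , 2F) ∷
     alternating (0F , 1F) (1F , 1F) (1F , 2F) (2F , 2F) (2F , 1F) ∷
     alternating (0F , 1F) (0F , 2F) (1F , 2F) (2F , 2F) (2F , 1F) ∷
     alternating (0F , 2F) (1F , 2F) (2F , 2F) (2F , 1F) (1F , 1F) ∷
     alternating (0F , 2F) (1F , 2F) (1F , 1F) (2F , 1F) (2F , 2F) ∷
     alternating (0F , 2F) (0F , 1F) (1F , 1F) (2F , 1F) (2F , 2F) ∷
     alternating (0F , 3F) (1F , 3F) (1F , 2F) (2F , 2F) (2F , 1F) ∷
     alternating (0F , 3F) (0F , 2F) (1F , 2F) (2F , 2F) (2F , 1F) ∷
     alternating (1F , 0F) (1F , 1F) (2F , 1F) (2F , 2F) (1F , 2F) ∷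
     alternating (1F , 0F) (1F , 1F) (1F , 2F) (2F , 2F) (2F , 1F) ∷
     sameColour (1F , 1F) (2F , 1F) (2F , 2F) ∷
     alternating (1F , 1F) (2F , 1F) (2F , 2F) (1F , 2F) (1F , 3F) ∷
     alternating (1F , 1F) (2F , 1F) (2F , 2F) (1F , 2F) (1F , 1F) ∷
     sameColour (1F , 2F) (2F , 2F) (2F , 1F) ∷
     alternating (1F , 3F) (1F , 2F) (1F , 1F) (2F , 1F) (2F , 2F) ∷
     alternating (1F , 4F) (1F , 3F) (1F , 2F) (2F , 2F) (2F , 1F) ∷
     alternating (2F , 1F) (2F , 2F) (1F , 2F) (1F , 3F) (2F , 3F) ∷ []) ∷
    (alternating (0F , 1F) (1F , 1F) (2F , 1F) (2F , 2F) (2F , 3F) ∷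
     alternating (0F , 1F) (1F , 1F) (1F , 2F) (2F , 2F) (2F , 3F) ∷
     alternating (0F , 1F) (0F , 2F) (1F , 2F) (2F , 2F) (2F , 3F) ∷
     alternating (0F , 2F) (1F , 2F) (2F , 2F) (2F , 3F) (1F , 3F) ∷
     alternating (0F , 2F) (1F , 2F) (1F , 3F) (2F , 3F) (2F , 2F) ∷
     alternating (0F , 2F) (0F , 3F) (1F , 3F) (2F , 3F) (2F , 2F) ∷
     alternating (0F , 3F) (1F , 3F) (2F , 3F) (2F , 2F) (1F , 2F) ∷
     alternating (0F , 3F) (1F , 3F) (2F , 3F) (2F , 2F) (2F , 1F) ∷
     alternating (0F , 3F) (1F , 3F) (1F , 2F) (2F , 2F) (2F , 3F) ∷
     alternating (0F , 3F) (0F , 2F) (1F , 2F) (2F , 2F) (2F , 3F) ∷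
     alternating (1F , 0F) (1F , 1F) (2F , 1F) (2F , 2F) (2F , 3F) ∷
     alternating (1F , 0F) (1F , 1F) (1F , 2F) (2F , 2F) (2F , 3F) ∷
     alternating (1F , 1F) (2F , 1F) (2F , 2F) (2F , 3F) (1F , 3F) ∷
     alternating (1F , 1F) (1F , 2F) (2F , 2F) (2F , 3F) (1F , 3F) ∷
     alternating (1F , 1F) (1F , 2F) (1F , 3F) (2F , 3F) (2F , 2F) ∷
     sameColour (1F , 2F) (2F , 2F) (2F , 3F) ∷
     alternating (1F , 2F) (2F , 2F) (2F , 3F) (1F , 3F) (1F , 4F) ∷
     alternating (1F , 2F) (2F , 2F) (2F , 3F) (1F , 3F) (1F , 2F) ∷
     alternating (1F , 2F) (1F , 3F) (2F , 3F) (2F , 2F) (2F , 1F) ∷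
     alternating (1F , 2F) (1F , 1F) (2F , 1F) (2F , 2F) (2F , 3F) ∷
     sameColour (1F , 3F) (2F , 3F) (2F , 2F) ∷
     alternating (1F , 4F) (1F , 3F) (2F , 3F) (2F , 2F) (2F , 1F) ∷
     alternating (1F , 4F) (1F , 3F) (1F , 2F) (2F , 2F) (2F , 3F) ∷
     alternating (2F , 1F) (1F , 1F) (1F , 2F) (2F , 2F) (2F , 3F) ∷
     sameColour (2F , 1F) (2F , 2F) (2F , 3F) ∷ []) ∷
    (sameColour (0F , 0F) (0F , 1F) (1F , 1F) ∷
     alternating (0F , 0F) (0F , 1F) (1F , 1F) (2F , 1F) (2F , 2F) ∷
     alternating (0F , 0F) (0F , 1F) (1F , 1F) (1F , 2F) (2F , 2F) ∷
     alternating (0F , 0F) (0F , 1F) (1F , 1F) (1F , 2F) (0F , 2F) ∷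
     alternating (0F , 0F) (0F , 1F) (1F , 1F) (1F , 2F) (1F , 3F) ∷
     sameColour (0F , 0F) (0F , 1F) (0F , 2F) ∷
     alternating (0F , 0F) (0F , 1F) (0F , 2F) (1F , 2F) (2F , 2F) ∷
     alternating (0F , 0F) (0F , 1F) (0F , 2F) (1F , 2F) (1F , 3F) ∷
     alternating (0F , 0F) (0F , 1F) (0F , 2F) (1F , 2F) (1F , 1F) ∷
     alternating (0F , 0F) (0F , 1F) (0F , 2F) (0F , 3F) (1F , 3F) ∷ []) ∷
    (sameColour (0F , 0F) (1F , 0F) (1F , 1F) ∷
     alternating (0F , 0F) (1F , 0F) (1F , 1F) (2F , 1F) (2F , 2F) ∷
     alternating (0F , 0F) (1F , 0F) (1F , 1F) (0F , 1F) (0F , 2F) ∷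
     alternating (0F , 0F) (1F , 0F) (1F , 1F) (0F , 1F) (0F , 0F) ∷
     alternating (0F , 0F) (1F , 0F) (1F , 1F) (1F , 2F) (2F , 2F) ∷
     alternating (0F , 0F) (1F , 0F) (1F , 1F) (1F , 2F) (0F , 2F) ∷
     alternating (0F , 0F) (1F , 0F) (1F , 1F) (1F , 2F) (1F , 3F) ∷
     sameColour (0F , 1F) (0F , 0F) (1F , 0F) ∷
     alternating (0F , 1F) (0F , 0F) (1F , 0F) (1F , 1F) (2F , 1F) ∷
     alternating (0F , 1F) (0F , 0F) (1F , 0F) (1F , 1F) (1F , 2F) ∷
     alternating (0F , 2F) (0F , 1F) (0F , 0F) (1F , 0F) (1F , 1F) ∷
     alternating (0F , 3F) (0F , 2F) (0F , 1F) (0F , 0F) (1F , 0F) ∷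
     alternating (1F , 0F) (0F , 0F) (0F , 1F) (1F , 1F) (2F , 1F) ∷
     alternating (1F , 0F) (0F , 0F) (0F , 1F) (1F , 1F) (1F , 2F) ∷
     alternating (1F , 0F) (0F , 0F) (0F , 1F) (0F , 2F) (1F , 2F) ∷ []) ∷
    (alternating (0F , 0F) (0F , 1F) (0F , 2F) (0F , 3F) (0F , 4F) ∷
     alternating (0F , 2F) (1F , 2F) (1F , 3F) (0F , 3F) (0F , 4F) ∷
     sameColour (0F , 2F) (0F , 3F) (0F , 4F) ∷ sameColour (0F , 4F) (0F , 3F) (1F , 3F) ∷
     alternating (0F , 4F) (0F , 3F) (1F , 3F) (2F , 3F) (2F , 2F) ∷
     alternating (0F , 4F) (0F , 3F) (1F , 3F) (1F , 2F) (2F , 2F) ∷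
     alternating (0F , 4F) (0F , 3F) (1F , 3F) (1F , 2F) (1F , 1F) ∷
     alternating (0F , 4F) (0F , 3F) (0F , 2F) (1F , 2F) (2F , 2F) ∷
     alternating (0F , 4F) (0F , 3F) (0F , 2F) (1F , 2F) (1F , 3F) ∷
     alternating (0F , 4F) (0F , 3F) (0F , 2F) (1F , 2F) (1F , 1F) ∷
     alternating (0F , 4F) (0F , 3F) (0F , 2F) (0F , 1F) (1F , 1F) ∷ []) ∷
    (alternating (0F , 1F) (0F , 2F) (0F , 3F) (0F , 4F) (1F , 4F) ∷
     alternating (0F , 2F) (1F , 2F) (1F , 3F) (1F , 4F) (0F , 4F) ∷
     alternating (0F , 2F) (0F , 3F) (1F , 3F) (1F , 4F) (0F , 4F) ∷
     alternating (0F , 2F) (0F , 3F) (0F , 4F) (1F , 4F) (1F , 3F) ∷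
     alternating (0F , 3F) (1F , 3F) (1F , 4F) (0F , 4F) (0F , 3F) ∷
     sameColour (0F , 3F) (0F , 4F) (1F , 4F) ∷
     alternating (0F , 3F) (0F , 4F) (1F , 4F) (1F , 3F) (2F , 3F) ∷
     alternating (0F , 3F) (0F , 4F) (1F , 4F) (1F , 3F) (1F , 2F) ∷
     sameColour (0F , 4F) (1F , 4F) (1F , 3F) ∷
     alternating (0F , 4F) (1F , 4F) (1F , 3F) (2F , 3F) (2F , 2F) ∷
     alternating (0F , 4F) (1F , 4F) (1F , 3F) (1F , 2F) (2F , 2F) ∷
     alternating (0F , 4F) (1F , 4F) (1F , 3F) (1F , 2F) (1F , 1F) ∷
     alternating (1F , 2F) (0F , 2F) (0F , 3F) (0F , 4F) (1F , 4F) ∷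
     alternating (1F , 2F) (1F , 3F) (0F , 3F) (0F , 4F) (1F , 4F) ∷
     alternating (1F , 4F) (0F , 4F) (0F , 3F) (1F , 3F) (2F , 3F) ∷ []) ∷
    (sameColour (0F , 0F) (1F , 0F) (2F , 0F) ∷
     alternating (0F , 0F) (0F , 1F) (1F , 1F) (1F , 0F) (2F , 0F) ∷
     alternating (0F , 2F) (1F , 2F) (1F , 1F) (1F , 0F) (2F , 0F) ∷
     alternating (0F , 2F) (0F , 1F) (1F , 1F) (1F , 0F) (2F , 0F) ∷
     alternating (0F , 2F) (0F , 1F) (0F , 0F) (1F , 0F) (2F , 0F) ∷
     alternating (1F , 1F) (0F , 1F) (0F , 0F) (1F , 0F) (2F , 0F) ∷
     sameColour (1F , 1F) (1F , 0F) (2F , 0F) ∷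
     alternating (1F , 3F) (1F , 2F) (1F , 1F) (1F , 0F) (2F , 0F) ∷
     alternating (2F , 0F) (1F , 0F) (1F , 1F) (2F , 1F) (2F , 2F) ∷
     alternating (2F , 0F) (1F , 0F) (1F , 1F) (1F , 2F) (2F , 2F) ∷ []) ∷
    (alternating (0F , 2F) (1F , 2F) (1F , 3F) (1F , 4F) (2F , 4F) ∷
     alternating (0F , 2F) (0F , 3F) (1F , 3F) (1F , 4F) (2F , 4F) ∷
     alternating (0F , 2F) (0F , 3F) (0F , 4F) (1F , 4F) (2F , 4F) ∷
     sameColour (0F , 4F) (1F , 4F) (2F , 4F) ∷
     alternating (0F , 4F) (0F , 3F) (1F , 3F) (1F , 4F) (2F , 4F) ∷
     alternating (1F , 1F) (1F , 2F) (1F , 3F) (1F , 4F) (2F , 4F) ∷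
     alternating (1F , 3F) (0F , 3F) (0F , 4F) (1F , 4F) (2F , 4F) ∷
     sameColour (1F , 3F) (1F , 4F) (2F , 4F) ∷
     alternating (2F , 2F) (1F , 2F) (1F , 3F) (1F , 4F) (2F , 4F) ∷
     alternating (2F , 2F) (2F , 3F) (1F , 3F) (1F , 4F) (2F , 4F) ∷ []) ∷
    (alternating (0F , 0F) (1F , 0F) (2F , 0F) (2F , 1F) (1F , 1F) ∷
     alternating (0F , 0F) (1F , 0F) (2F , 0F) (2F , 1F) (2F , 2F) ∷
     alternating (0F , 0F) (1F , 0F) (1F , 1F) (2F , 1F) (2F , 0F) ∷
     alternating (0F , 0F) (0F , 1F) (1F , 1F) (2F , 1F) (2F , 0F) ∷
     alternating (0F , 1F) (1F , 1F) (2F , 1F) (2F , 0F) (1F , 0F) ∷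
     alternating (0F , 1F) (1F , 1F) (1F , 0F) (2F , 0F) (2F , 1F) ∷
     alternating (0F , 1F) (0F , 0F) (1F , 0F) (2F , 0F) (2F , 1F) ∷
     alternating (0F , 2F) (1F , 2F) (2F , 2F) (2F , 1F) (2F , 0F) ∷
     alternating (0F , 2F) (1F , 2F) (1F , 1F) (2F , 1F) (2F , 0F) ∷
     alternating (0F , 2F) (0F , 1F) (1F , 1F) (2F , 1F) (2F , 0F) ∷
     sameColour (1F , 0F) (2F , 0F) (2F , 1F) ∷
     alternating (1F , 0F) (2F , 0F) (2F , 1F) (1F , 1F) (1F , 2F) ∷
     alternating (1F , 0F) (2F , 0F) (2F , 1F) (1F , 1F) (1F , 0F) ∷
     alternating (1F , 0F) (2F , 0F) (2F , 1F) (2F , 2F) (1F , 2F) ∷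
     alternating (1F , 0F) (2F , 0F) (2F , 1F) (2F , 2F) (2F , 3F) ∷
     sameColour (1F , 1F) (2F , 1F) (2F , 0F) ∷
     alternating (1F , 1F) (1F , 2F) (2F , 2F) (2F , 1F) (2F , 0F) ∷
     alternating (1F , 1F) (1F , 0F) (2F , 0F) (2F , 1F) (2F , 2F) ∷
     alternating (1F , 2F) (1F , 1F) (1F , 0F) (2F , 0F) (2F , 1F) ∷
     alternating (1F , 3F) (2F , 3F) (2F , 2F) (2F , 1F) (2F , 0F) ∷
     alternating (1F , 3F) (1F , 2F) (2F , 2F) (2F , 1F) (2F , 0F) ∷
     alternating (1F , 3F) (1F , 2F) (1F , 1F) (2F , 1F) (2F , 0F) ∷
     alternating (2F , 0F) (2F , 1F) (1F , 1F) (1F , 2F) (2F , 2F) ∷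
     sameColour (2F , 0F) (2F , 1F) (2F , 2F) ∷ []) ∷
    (alternating (0F , 2F) (1F , 2F) (2F , 2F) (2F , 3F) (2F , 4F) ∷
     alternating (0F , 2F) (1F , 2F) (1F , 3F) (2F , 3F) (2F , 4F) ∷
     alternating (0F , 2F) (0F , 3F) (1F , 3F) (2F , 3F) (2F , 4F) ∷
     alternating (0F , 3F) (1F , 3F) (2F , 3F) (2F , 4F) (1F , 4F) ∷
     alternating (0F , 3F) (1F , 3F) (1F , 4F) (2F , 4F) (2F , 3F) ∷
     alternating (0F , 3F) (0F , 4F) (1F , 4F) (2F , 4F) (2F , 3F) ∷
     alternating (0F , 4F) (1F , 4F) (2F , 4F) (2F , 3F) (1F , 3F) ∷
     alternating (0F , 4F) (1F , 4F) (2F , 4F) (2F , 3F) (2F , 2F) ∷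
     alternating (0F , 4F) (1F , 4F) (1F , 3F) (2F , 3F) (2F , 4F) ∷
     alternating (0F , 4F) (0F , 3F) (1F , 3F) (2F , 3F) (2F , 4F) ∷
     alternating (1F , 1F) (2F , 1F) (2F , 2F) (2F , 3F) (2F , 4F) ∷
     alternating (1F , 1F) (1F , 2F) (2F , 2F) (2F , 3F) (2F , 4F) ∷
     alternating (1F , 1F) (1F , 2F) (1F , 3F) (2F , 3F) (2F , 4F) ∷
     alternating (1F , 2F) (2F , 2F) (2F , 3F) (2F , 4F) (1F , 4F) ∷
     alternating (1F , 2F) (1F , 3F) (2F , 3F) (2F , 4F) (1F , 4F) ∷
     alternating (1F , 2F) (1F , 3F) (1F , 4F) (2F , 4F) (2F , 3F) ∷
     sameColour (1F , 3F) (2F , 3F) (2F , 4F) ∷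
     alternating (1F , 3F) (2F , 3F) (2F , 4F) (1F , 4F) (1F , 3F) ∷
     alternating (1F , 3F) (1F , 4F) (2F , 4F) (2F , 3F) (2F , 2F) ∷
     alternating (1F , 3F) (1F , 2F) (2F , 2F) (2F , 3F) (2F , 4F) ∷
     sameColour (1F , 4F) (2F , 4F) (2F , 3F) ∷
     alternating (1F , 4F) (2F , 4F) (2F , 3F) (2F , 2F) (2F , 1F) ∷
     alternating (2F , 0F) (2F , 1F) (2F , 2F) (2F , 3F) (2F , 4F) ∷
     alternating (2F , 2F) (1F , 2F) (1F , 3F) (2F , 3F) (2F , 4F) ∷
     sameColour (2F , 2F) (2F , 3F) (2F , 4F) ∷ []) ∷ []
  }

across44 along44 : Vec (Vec (Fin 24) 4) 4
across44 =
  (# 5 ∷ # 1 ∷ # 7 ∷ # 15 ∷ []) ∷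
  (# 8 ∷ # 0 ∷ # 10 ∷ # 16 ∷ []) ∷
  (# 17 ∷ # 13 ∷ # 19 ∷ # 22 ∷ []) ∷
  (# 0 ∷ # 0 ∷ # 0 ∷ # 0 ∷ []) ∷ []
along44 =
  (# 4 ∷ # 6 ∷ # 14 ∷ # 0 ∷ []) ∷
  (# 2 ∷ # 3 ∷ # 9 ∷ # 0 ∷ []) ∷
  (# 11 ∷ # 12 ∷ # 18 ∷ # 0 ∷ []) ∷
  (# 20 ∷ # 21 ∷ # 23 ∷ # 0 ∷ []) ∷ []
certificate44 : Certificate (finiteGrid 4 4) 3 22
certificate44 = record
  { edges =
      ((2F , 1F) , (1F , 1F)) ∷ ((1F , 1F) , (0F , 1F)) ∷ ((1F , 0F) , (1F , 1F)) ∷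
      ((1F , 1F) , (1F , 2F)) ∷ ((0F , 0F) , (0F , 1F)) ∷ ((0F , 0F) , (1F , 0F)) ∷
      ((0F , 1F) , (0F , 2F)) ∷ ((0F , 2F) , (1F , 2F)) ∷ ((1F , 0F) , (2F , 0F)) ∷
      ((1F , 2F) , (1F , 3F)) ∷ ((1F , 2F) , (2F , 2F)) ∷ ((2F , 0F) , (2F , 1F)) ∷
      ((2F , 1F) , (2F , 2F)) ∷ ((2F , 1F) , (3F , 1F)) ∷ ((0F , 2F) , (0F , 3F)) ∷
      ((0F , 3F) , (1F , 3F)) ∷ ((1F , 3F) , (2F , 3F)) ∷ ((2F , 0F) , (3F , 0F)) ∷
      ((2F , 2F) , (2F , 3F)) ∷ ((2F , 2F) , (3F , 2F)) ∷ ((3F , 0F) , (3F , 1F)) ∷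
      ((3F , 1F) , (3F , 2F)) ∷ ((2F , 3F) , (3F , 3F)) ∷ ((3F , 2F) , (3F , 3F)) ∷ []
  ; index = gridIndex across44 along44
  ; buckets =
    (sameColour (0F , 1F) (1F , 1F) (1F , 0F) ∷ sameColour (1F , 0F) (1F , 1F) (2F , 1F) ∷ []) ∷
    (sameColour (0F , 1F) (1F , 1F) (1F , 2F) ∷ sameColour (1F , 0F) (1F , 1F) (1F , 2F) ∷
     sameColour (1F , 2F) (1F , 1F) (2F , 1F) ∷ []) ∷
    (sameColour (0F , 0F) (0F , 1F) (1F , 1F) ∷ []) ∷
    (sameColour (0F , 0F) (1F , 0F) (1F , 1F) ∷
     alternating (0F , 0F) (1F , 0F) (1F , 1F) (0F , 1F) (0F , 0F) ∷
     sameColour (0F , 1F) (0F , 0F) (1F , 0F) ∷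
     alternating (0F , 1F) (0F , 0F) (1F , 0F) (1F , 1F) (2F , 1F) ∷
     alternating (0F , 1F) (0F , 0F) (1F , 0F) (1F , 1F) (1F , 2F) ∷
     alternating (1F , 0F) (0F , 0F) (0F , 1F) (1F , 1F) (2F , 1F) ∷
     alternating (1F , 0F) (0F , 0F) (0F , 1F) (1F , 1F) (1F , 2F) ∷ []) ∷
    (alternating (0F , 0F) (1F , 0F) (1F , 1F) (0F , 1F) (0F , 2F) ∷
     sameColour (0F , 0F) (0F , 1F) (0F , 2F) ∷ sameColour (0F , 2F) (0F , 1F) (1F , 1F) ∷
     alternating (0F , 2F) (0F , 1F) (0F , 0F) (1F , 0F) (1F , 1F) ∷ []) ∷
    (alternating (0F , 0F) (1F , 0F) (1F , 1F) (1F , 2F) (0F , 2F) ∷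
     alternating (0F , 0F) (0F , 1F) (1F , 1F) (1F , 2F) (0F , 2F) ∷
     alternating (0F , 0F) (0F , 1F) (0F , 2F) (1F , 2F) (1F , 1F) ∷
     alternating (0F , 1F) (1F , 1F) (1F , 2F) (0F , 2F) (0F , 1F) ∷
     sameColour (0F , 1F) (0F , 2F) (1F , 2F) ∷
     alternating (0F , 1F) (0F , 2F) (1F , 2F) (1F , 1F) (2F , 1F) ∷
     alternating (0F , 1F) (0F , 2F) (1F , 2F) (1F , 1F) (1F , 0F) ∷
     sameColour (0F , 2F) (1F , 2F) (1F , 1F) ∷
     alternating (1F , 0F) (0F , 0F) (0F , 1F) (0F , 2F) (1F , 2F) ∷
     alternating (1F , 0F) (1F , 1F) (0F , 1F) (0F , 2F) (1F , 2F) ∷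
     alternating (1F , 2F) (0F , 2F) (0F , 1F) (1F , 1F) (2F , 1F) ∷ []) ∷
    (sameColour (0F , 0F) (1F , 0F) (2F , 0F) ∷
     alternating (0F , 0F) (0F , 1F) (1F , 1F) (1F , 0F) (2F , 0F) ∷
     alternating (0F , 2F) (1F , 2F) (1F , 1F) (1F , 0F) (2F , 0F) ∷
     alternating (0F , 2F) (0F , 1F) (1F , 1F) (1F , 0F) (2F , 0F) ∷
     alternating (0F , 2F) (0F , 1F) (0F , 0F) (1F , 0F) (2F , 0F) ∷
     alternating (1F , 1F) (0F , 1F) (0F , 0F) (1F , 0F) (2F , 0F) ∷
     sameColour (1F , 1F) (1F , 0F) (2F , 0F) ∷ []) ∷
    (alternating (0F , 0F) (1F , 0F) (1F , 1F) (1F , 2F) (1F , 3F) ∷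
     alternating (0F , 0F) (0F , 1F) (1F , 1F) (1F , 2F) (1F , 3F) ∷
     alternating (0F , 0F) (0F , 1F) (0F , 2F) (1F , 2F) (1F , 3F) ∷
     sameColour (0F , 2F) (1F , 2F) (1F , 3F) ∷
     alternating (0F , 2F) (0F , 1F) (1F , 1F) (1F , 2F) (1F , 3F) ∷
     alternating (1F , 1F) (0F , 1F) (0F , 2F) (1F , 2F) (1F , 3F) ∷
     sameColour (1F , 1F) (1F , 2F) (1F , 3F) ∷
     alternating (1F , 3F) (1F , 2F) (1F , 1F) (1F , 0F) (2F , 0F) ∷ []) ∷
    (alternating (0F , 0F) (1F , 0F) (1F , 1F) (1F , 2F) (2F , 2F) ∷
     alternating (0F , 0F) (0F , 1F) (1F , 1F) (1F , 2F) (2F , 2F) ∷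
     alternating (0F , 0F) (0F , 1F) (0F , 2F) (1F , 2F) (2F , 2F) ∷
     sameColour (0F , 2F) (1F , 2F) (2F , 2F) ∷
     alternating (0F , 2F) (0F , 1F) (1F , 1F) (1F , 2F) (2F , 2F) ∷
     alternating (1F , 1F) (0F , 1F) (0F , 2F) (1F , 2F) (2F , 2F) ∷
     sameColour (1F , 1F) (1F , 2F) (2F , 2F) ∷ sameColour (1F , 3F) (1F , 2F) (2F , 2F) ∷
     alternating (2F , 0F) (1F , 0F) (1F , 1F) (1F , 2F) (2F , 2F) ∷ []) ∷
    (alternating (0F , 0F) (1F , 0F) (2F , 0F) (2F , 1F) (1F , 1F) ∷
     alternating (0F , 0F) (1F , 0F) (1F , 1F) (2F , 1F) (2F , 0F) ∷
     alternating (0F , 0F) (0F , 1F) (1F , 1F) (2F , 1F) (2F , 0F) ∷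
     alternating (0F , 1F) (1F , 1F) (2F , 1F) (2F , 0F) (1F , 0F) ∷
     alternating (0F , 1F) (1F , 1F) (1F , 0F) (2F , 0F) (2F , 1F) ∷
     alternating (0F , 1F) (0F , 0F) (1F , 0F) (2F , 0F) (2F , 1F) ∷
     alternating (0F , 2F) (1F , 2F) (1F , 1F) (2F , 1F) (2F , 0F) ∷
     alternating (0F , 2F) (0F , 1F) (1F , 1F) (2F , 1F) (2F , 0F) ∷
     sameColour (1F , 0F) (2F , 0F) (2F , 1F) ∷
     alternating (1F , 0F) (2F , 0F) (2F , 1F) (1F , 1F) (1F , 2F) ∷
     alternating (1F , 0F) (2F , 0F) (2F , 1F) (1F , 1F) (1F , 0F) ∷
     sameColour (1F , 1F) (2F , 1F) (2F , 0F) ∷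
     alternating (1F , 2F) (1F , 1F) (1F , 0F) (2F , 0F) (2F , 1F) ∷
     alternating (1F , 3F) (1F , 2F) (1F , 1F) (2F , 1F) (2F , 0F) ∷
     alternating (2F , 0F) (2F , 1F) (1F , 1F) (1F , 2F) (2F , 2F) ∷ []) ∷
    (alternating (0F , 0F) (1F , 0F) (2F , 0F) (2F , 1F) (2F , 2F) ∷
     alternating (0F , 0F) (1F , 0F) (1F , 1F) (2F , 1F) (2F , 2F) ∷
     alternating (0F , 0F) (0F , 1F) (1F , 1F) (2F , 1F) (2F , 2F) ∷
     alternating (0F , 1F) (1F , 1F) (2F , 1F) (2F , 2F) (1F , 2F) ∷
     alternating (0F , 1F) (1F , 1F) (1F , 2F) (2F , 2F) (2F , 1F) ∷
     alternating (0F , 1F) (0F , 2F) (1F , 2F) (2F , 2F) (2F , 1F) ∷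
     alternating (0F , 2F) (1F , 2F) (2F , 2F) (2F , 1F) (1F , 1F) ∷
     alternating (0F , 2F) (1F , 2F) (2F , 2F) (2F , 1F) (2F , 0F) ∷
     alternating (0F , 2F) (1F , 2F) (1F , 1F) (2F , 1F) (2F , 2F) ∷
     alternating (0F , 2F) (0F , 1F) (1F , 1F) (2F , 1F) (2F , 2F) ∷
     alternating (1F , 0F) (2F , 0F) (2F , 1F) (2F , 2F) (1F , 2F) ∷
     alternating (1F , 0F) (1F , 1F) (2F , 1F) (2F , 2F) (1F , 2F) ∷
     alternating (1F , 0F) (1F , 1F) (1F , 2F) (2F , 2F) (2F , 1F) ∷
     sameColour (1F , 1F) (2F , 1F) (2F , 2F) ∷
     alternating (1F , 1F) (2F , 1F) (2F , 2F) (1F , 2F) (1F , 3F) ∷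
     alternating (1F , 1F) (2F , 1F) (2F , 2F) (1F , 2F) (1F , 1F) ∷
     alternating (1F , 1F) (1F , 2F) (2F , 2F) (2F , 1F) (2F , 0F) ∷
     alternating (1F , 1F) (1F , 0F) (2F , 0F) (2F , 1F) (2F , 2F) ∷
     sameColour (1F , 2F) (2F , 2F) (2F , 1F) ∷
     alternating (1F , 3F) (1F , 2F) (2F , 2F) (2F , 1F) (2F , 0F) ∷
     alternating (1F , 3F) (1F , 2F) (1F , 1F) (2F , 1F) (2F , 2F) ∷
     alternating (2F , 0F) (1F , 0F) (1F , 1F) (2F , 1F) (2F , 2F) ∷
     sameColour (2F , 0F) (2F , 1F) (2F , 2F) ∷ []) ∷
    (alternating (0F , 0F) (1F , 0F) (2F , 0F) (2F , 1F) (3F , 1F) ∷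
     alternating (0F , 0F) (1F , 0F) (1F , 1F) (2F , 1F) (3F , 1F) ∷
     alternating (0F , 0F) (0F , 1F) (1F , 1F) (2F , 1F) (3F , 1F) ∷
     alternating (0F , 2F) (1F , 2F) (2F , 2F) (2F , 1F) (3F , 1F) ∷
     alternating (0F , 2F) (1F , 2F) (1F , 1F) (2F , 1F) (3F , 1F) ∷
     alternating (0F , 2F) (0F , 1F) (1F , 1F) (2F , 1F) (3F , 1F) ∷
     sameColour (1F , 1F) (2F , 1F) (3F , 1F) ∷
     alternating (1F , 1F) (1F , 2F) (2F , 2F) (2F , 1F) (3F , 1F) ∷
     alternating (1F , 1F) (1F , 0F) (2F , 0F) (2F , 1F) (3F , 1F) ∷
     alternating (1F , 3F) (1F , 2F) (2F , 2F) (2F , 1F) (3F , 1F) ∷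
     alternating (1F , 3F) (1F , 2F) (1F , 1F) (2F , 1F) (3F , 1F) ∷
     alternating (2F , 0F) (1F , 0F) (1F , 1F) (2F , 1F) (3F , 1F) ∷
     sameColour (2F , 0F) (2F , 1F) (3F , 1F) ∷
     alternating (2F , 2F) (1F , 2F) (1F , 1F) (2F , 1F) (3F , 1F) ∷
     sameColour (2F , 2F) (2F , 1F) (3F , 1F) ∷ []) ∷
    (alternating (0F , 1F) (1F , 1F) (1F , 2F) (0F , 2F) (0F , 3F) ∷
     sameColour (0F , 1F) (0F , 2F) (0F , 3F) ∷ sameColour (0F , 3F) (0F , 2F) (1F , 2F) ∷
     alternating (0F , 3F) (0F , 2F) (1F , 2F) (2F , 2F) (2F , 1F) ∷
     alternating (0F , 3F) (0F , 2F) (1F , 2F) (1F , 1F) (2F , 1F) ∷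
     alternating (0F , 3F) (0F , 2F) (1F , 2F) (1F , 1F) (1F , 0F) ∷
     alternating (0F , 3F) (0F , 2F) (0F , 1F) (1F , 1F) (2F , 1F) ∷
     alternating (0F , 3F) (0F , 2F) (0F , 1F) (1F , 1F) (1F , 2F) ∷
     alternating (0F , 3F) (0F , 2F) (0F , 1F) (1F , 1F) (1F , 0F) ∷
     alternating (0F , 3F) (0F , 2F) (0F , 1F) (0F , 0F) (1F , 0F) ∷ []) ∷
    (alternating (0F , 0F) (0F , 1F) (0F , 2F) (0F , 3F) (1F , 3F) ∷
     alternating (0F , 1F) (1F , 1F) (1F , 2F) (1F , 3F) (0F , 3F) ∷
     alternating (0F , 1F) (0F , 2F) (1F , 2F) (1F , 3F) (0F , 3F) ∷
     alternating (0F , 1F) (0F , 2F) (0F , 3F) (1F , 3F) (1F , 2F) ∷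
     alternating (0F , 2F) (1F , 2F) (1F , 3F) (0F , 3F) (0F , 2F) ∷
     sameColour (0F , 2F) (0F , 3F) (1F , 3F) ∷
     alternating (0F , 2F) (0F , 3F) (1F , 3F) (1F , 2F) (2F , 2F) ∷
     alternating (0F , 2F) (0F , 3F) (1F , 3F) (1F , 2F) (1F , 1F) ∷
     sameColour (0F , 3F) (1F , 3F) (1F , 2F) ∷
     alternating (0F , 3F) (1F , 3F) (1F , 2F) (2F , 2F) (2F , 1F) ∷
     alternating (0F , 3F) (1F , 3F) (1F , 2F) (1F , 1F) (2F , 1F) ∷
     alternating (0F , 3F) (1F , 3F) (1F , 2F) (1F , 1F) (1F , 0F) ∷
     alternating (1F , 1F) (0F , 1F) (0F , 2F) (0F , 3F) (1F , 3F) ∷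
     alternating (1F , 1F) (1F , 2F) (0F , 2F) (0F , 3F) (1F , 3F) ∷
     alternating (1F , 3F) (0F , 3F) (0F , 2F) (1F , 2F) (2F , 2F) ∷ []) ∷
    (alternating (0F , 1F) (1F , 1F) (1F , 2F) (1F , 3F) (2F , 3F) ∷
     alternating (0F , 1F) (0F , 2F) (1F , 2F) (1F , 3F) (2F , 3F) ∷
     alternating (0F , 1F) (0F , 2F) (0F , 3F) (1F , 3F) (2F , 3F) ∷
     sameColour (0F , 3F) (1F , 3F) (2F , 3F) ∷
     alternating (0F , 3F) (0F , 2F) (1F , 2F) (1F , 3F) (2F , 3F) ∷
     alternating (1F , 0F) (1F , 1F) (1F , 2F) (1F , 3F) (2F , 3F) ∷
     alternating (1F , 2F) (0F , 2F) (0F , 3F) (1F , 3F) (2F , 3F) ∷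
     sameColour (1F , 2F) (1F , 3F) (2F , 3F) ∷
     alternating (2F , 1F) (1F , 1F) (1F , 2F) (1F , 3F) (2F , 3F) ∷
     alternating (2F , 1F) (2F , 2F) (1F , 2F) (1F , 3F) (2F , 3F) ∷ []) ∷
    (alternating (0F , 1F) (1F , 1F) (2F , 1F) (2F , 0F) (3F , 0F) ∷
     alternating (0F , 1F) (1F , 1F) (1F , 0F) (2F , 0F) (3F , 0F) ∷
     alternating (0F , 1F) (0F , 0F) (1F , 0F) (2F , 0F) (3F , 0F) ∷
     sameColour (1F , 0F) (2F , 0F) (3F , 0F) ∷
     alternating (1F , 0F) (1F , 1F) (2F , 1F) (2F , 0F) (3F , 0F) ∷
     alternating (1F , 2F) (2F , 2F) (2F , 1F) (2F , 0F) (3F , 0F) ∷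
     alternating (1F , 2F) (1F , 1F) (2F , 1F) (2F , 0F) (3F , 0F) ∷
     alternating (1F , 2F) (1F , 1F) (1F , 0F) (2F , 0F) (3F , 0F) ∷
     alternating (2F , 1F) (1F , 1F) (1F , 0F) (2F , 0F) (3F , 0F) ∷
     sameColour (2F , 1F) (2F , 0F) (3F , 0F) ∷ []) ∷
    (alternating (0F , 1F) (1F , 1F) (2F , 1F) (2F , 2F) (2F , 3F) ∷
     alternating (0F , 1F) (1F , 1F) (1F , 2F) (2F , 2F) (2F , 3F) ∷
     alternating (0F , 1F) (0F , 2F) (1F , 2F) (2F , 2F) (2F , 3F) ∷
     alternating (0F , 2F) (1F , 2F) (2F , 2F) (2F , 3F) (1F , 3F) ∷
     alternating (0F , 2F) (1F , 2F) (1F , 3F) (2F , 3F) (2F , 2F) ∷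
     alternating (0F , 2F) (0F , 3F) (1F , 3F) (2F , 3F) (2F , 2F) ∷
     alternating (0F , 3F) (1F , 3F) (2F , 3F) (2F , 2F) (1F , 2F) ∷
     alternating (0F , 3F) (1F , 3F) (2F , 3F) (2F , 2F) (2F , 1F) ∷
     alternating (0F , 3F) (1F , 3F) (1F , 2F) (2F , 2F) (2F , 3F) ∷
     alternating (0F , 3F) (0F , 2F) (1F , 2F) (2F , 2F) (2F , 3F) ∷
     alternating (1F , 0F) (2F , 0F) (2F , 1F) (2F , 2F) (2F , 3F) ∷
     alternating (1F , 0F) (1F , 1F) (2F , 1F) (2F , 2F) (2F , 3F) ∷
     alternating (1F , 0F) (1F , 1F) (1F , 2F) (2F , 2F) (2F , 3F) ∷
     alternating (1F , 1F) (2F , 1F) (2F , 2F) (2F , 3F) (1F , 3F) ∷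
     alternating (1F , 1F) (1F , 2F) (2F , 2F) (2F , 3F) (1F , 3F) ∷
     alternating (1F , 1F) (1F , 2F) (1F , 3F) (2F , 3F) (2F , 2F) ∷
     sameColour (1F , 2F) (2F , 2F) (2F , 3F) ∷
     alternating (1F , 2F) (2F , 2F) (2F , 3F) (1F , 3F) (1F , 2F) ∷
     alternating (1F , 2F) (1F , 3F) (2F , 3F) (2F , 2F) (2F , 1F) ∷
     alternating (1F , 2F) (1F , 1F) (2F , 1F) (2F , 2F) (2F , 3F) ∷
     sameColour (1F , 3F) (2F , 3F) (2F , 2F) ∷
     alternating (1F , 3F) (2F , 3F) (2F , 2F) (2F , 1F) (3F , 1F) ∷
     alternating (1F , 3F) (2F , 3F) (2F , 2F) (2F , 1F) (2F , 0F) ∷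
     alternating (2F , 1F) (1F , 1F) (1F , 2F) (2F , 2F) (2F , 3F) ∷
     sameColour (2F , 1F) (2F , 2F) (2F , 3F) ∷
     alternating (2F , 3F) (2F , 2F) (2F , 1F) (2F , 0F) (3F , 0F) ∷ []) ∷
    (alternating (0F , 1F) (1F , 1F) (2F , 1F) (2F , 2F) (3F , 2F) ∷
     alternating (0F , 1F) (1F , 1F) (1F , 2F) (2F , 2F) (3F , 2F) ∷
     alternating (0F , 1F) (0F , 2F) (1F , 2F) (2F , 2F) (3F , 2F) ∷
     alternating (0F , 3F) (1F , 3F) (2F , 3F) (2F , 2F) (3F , 2F) ∷
     alternating (0F , 3F) (1F , 3F) (1F , 2F) (2F , 2F) (3F , 2F) ∷
     alternating (0F , 3F) (0F , 2F) (1F , 2F) (2F , 2F) (3F , 2F) ∷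
     alternating (1F , 0F) (2F , 0F) (2F , 1F) (2F , 2F) (3F , 2F) ∷
     alternating (1F , 0F) (1F , 1F) (2F , 1F) (2F , 2F) (3F , 2F) ∷
     alternating (1F , 0F) (1F , 1F) (1F , 2F) (2F , 2F) (3F , 2F) ∷
     sameColour (1F , 2F) (2F , 2F) (3F , 2F) ∷
     alternating (1F , 2F) (1F , 3F) (2F , 3F) (2F , 2F) (3F , 2F) ∷
     alternating (1F , 2F) (1F , 1F) (2F , 1F) (2F , 2F) (3F , 2F) ∷
     alternating (2F , 1F) (1F , 1F) (1F , 2F) (2F , 2F) (3F , 2F) ∷
     sameColour (2F , 1F) (2F , 2F) (3F , 2F) ∷
     alternating (2F , 3F) (1F , 3F) (1F , 2F) (2F , 2F) (3F , 2F) ∷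
     sameColour (2F , 3F) (2F , 2F) (3F , 2F) ∷
     alternating (3F , 0F) (2F , 0F) (2F , 1F) (2F , 2F) (3F , 2F) ∷ []) ∷
    (alternating (0F , 0F) (1F , 0F) (2F , 0F) (3F , 0F) (3F , 1F) ∷
     alternating (0F , 1F) (1F , 1F) (2F , 1F) (3F , 1F) (3F , 0F) ∷
     alternating (1F , 0F) (2F , 0F) (3F , 0F) (3F , 1F) (2F , 1F) ∷
     alternating (1F , 0F) (2F , 0F) (2F , 1F) (3F , 1F) (3F , 0F) ∷
     alternating (1F , 0F) (1F , 1F) (2F , 1F) (3F , 1F) (3F , 0F) ∷
     alternating (1F , 1F) (2F , 1F) (3F , 1F) (3F , 0F) (2F , 0F) ∷
     alternating (1F , 1F) (2F , 1F) (2F , 0F) (3F , 0F) (3F , 1F) ∷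
     alternating (1F , 1F) (1F , 0F) (2F , 0F) (3F , 0F) (3F , 1F) ∷
     alternating (1F , 2F) (2F , 2F) (2F , 1F) (3F , 1F) (3F , 0F) ∷
     alternating (1F , 2F) (1F , 1F) (2F , 1F) (3F , 1F) (3F , 0F) ∷
     sameColour (2F , 0F) (3F , 0F) (3F , 1F) ∷
     alternating (2F , 0F) (3F , 0F) (3F , 1F) (2F , 1F) (2F , 2F) ∷
     alternating (2F , 0F) (3F , 0F) (3F , 1F) (2F , 1F) (2F , 0F) ∷
     sameColour (2F , 1F) (3F , 1F) (3F , 0F) ∷
     alternating (2F , 2F) (2F , 1F) (2F , 0F) (3F , 0F) (3F , 1F) ∷
     alternating (2F , 3F) (2F , 2F) (2F , 1F) (3F , 1F) (3F , 0F) ∷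
     alternating (3F , 0F) (3F , 1F) (2F , 1F) (2F , 2F) (3F , 2F) ∷ []) ∷
    (alternating (0F , 1F) (1F , 1F) (2F , 1F) (3F , 1F) (3F , 2F) ∷
     alternating (0F , 2F) (1F , 2F) (2F , 2F) (3F , 2F) (3F , 1F) ∷
     alternating (1F , 0F) (2F , 0F) (3F , 0F) (3F , 1F) (3F , 2F) ∷
     alternating (1F , 0F) (2F , 0F) (2F , 1F) (3F , 1F) (3F , 2F) ∷
     alternating (1F , 0F) (1F , 1F) (2F , 1F) (3F , 1F) (3F , 2F) ∷
     alternating (1F , 1F) (2F , 1F) (3F , 1F) (3F , 2F) (2F , 2F) ∷
     alternating (1F , 1F) (2F , 1F) (2F , 2F) (3F , 2F) (3F , 1F) ∷
     alternating (1F , 1F) (1F , 2F) (2F , 2F) (3F , 2F) (3F , 1F) ∷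
     alternating (1F , 2F) (2F , 2F) (3F , 2F) (3F , 1F) (2F , 1F) ∷
     alternating (1F , 2F) (2F , 2F) (3F , 2F) (3F , 1F) (3F , 0F) ∷
     alternating (1F , 2F) (2F , 2F) (2F , 1F) (3F , 1F) (3F , 2F) ∷
     alternating (1F , 2F) (1F , 1F) (2F , 1F) (3F , 1F) (3F , 2F) ∷
     alternating (1F , 3F) (2F , 3F) (2F , 2F) (3F , 2F) (3F , 1F) ∷
     alternating (1F , 3F) (1F , 2F) (2F , 2F) (3F , 2F) (3F , 1F) ∷
     alternating (2F , 0F) (3F , 0F) (3F , 1F) (3F , 2F) (2F , 2F) ∷
     alternating (2F , 0F) (2F , 1F) (3F , 1F) (3F , 2F) (2F , 2F) ∷
     alternating (2F , 0F) (2F , 1F) (2F , 2F) (3F , 2F) (3F , 1F) ∷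
     sameColour (2F , 1F) (3F , 1F) (3F , 2F) ∷
     alternating (2F , 1F) (3F , 1F) (3F , 2F) (2F , 2F) (2F , 3F) ∷
     alternating (2F , 1F) (3F , 1F) (3F , 2F) (2F , 2F) (2F , 1F) ∷
     alternating (2F , 1F) (2F , 2F) (3F , 2F) (3F , 1F) (3F , 0F) ∷
     alternating (2F , 1F) (2F , 0F) (3F , 0F) (3F , 1F) (3F , 2F) ∷
     sameColour (2F , 2F) (3F , 2F) (3F , 1F) ∷
     alternating (2F , 3F) (2F , 2F) (3F , 2F) (3F , 1F) (3F , 0F) ∷
     alternating (2F , 3F) (2F , 2F) (2F , 1F) (3F , 1F) (3F , 2F) ∷
     alternating (3F , 0F) (2F , 0F) (2F , 1F) (3F , 1F) (3F , 2F) ∷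
     sameColour (3F , 0F) (3F , 1F) (3F , 2F) ∷ []) ∷
    (alternating (0F , 2F) (1F , 2F) (2F , 2F) (2F , 3F) (3F , 3F) ∷
     alternating (0F , 2F) (1F , 2F) (1F , 3F) (2F , 3F) (3F , 3F) ∷
     alternating (0F , 2F) (0F , 3F) (1F , 3F) (2F , 3F) (3F , 3F) ∷
     alternating (1F , 1F) (2F , 1F) (2F , 2F) (2F , 3F) (3F , 3F) ∷
     alternating (1F , 1F) (1F , 2F) (2F , 2F) (2F , 3F) (3F , 3F) ∷
     alternating (1F , 1F) (1F , 2F) (1F , 3F) (2F , 3F) (3F , 3F) ∷
     sameColour (1F , 3F) (2F , 3F) (3F , 3F) ∷
     alternating (1F , 3F) (1F , 2F) (2F , 2F) (2F , 3F) (3F , 3F) ∷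
     alternating (2F , 0F) (2F , 1F) (2F , 2F) (2F , 3F) (3F , 3F) ∷
     alternating (2F , 2F) (1F , 2F) (1F , 3F) (2F , 3F) (3F , 3F) ∷
     sameColour (2F , 2F) (2F , 3F) (3F , 3F) ∷
     alternating (3F , 1F) (2F , 1F) (2F , 2F) (2F , 3F) (3F , 3F) ∷
     alternating (3F , 1F) (3F , 2F) (2F , 2F) (2F , 3F) (3F , 3F) ∷ []) ∷
    (alternating (0F , 2F) (1F , 2F) (2F , 2F) (3F , 2F) (3F , 3F) ∷
     alternating (0F , 3F) (1F , 3F) (2F , 3F) (3F , 3F) (3F , 2F) ∷
     alternating (1F , 1F) (2F , 1F) (3F , 1F) (3F , 2F) (3F , 3F) ∷
     alternating (1F , 1F) (2F , 1F) (2F , 2F) (3F , 2F) (3F , 3F) ∷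
     alternating (1F , 1F) (1F , 2F) (2F , 2F) (3F , 2F) (3F , 3F) ∷
     alternating (1F , 2F) (2F , 2F) (3F , 2F) (3F , 3F) (2F , 3F) ∷
     alternating (1F , 2F) (2F , 2F) (2F , 3F) (3F , 3F) (3F , 2F) ∷
     alternating (1F , 2F) (1F , 3F) (2F , 3F) (3F , 3F) (3F , 2F) ∷
     alternating (1F , 3F) (2F , 3F) (3F , 3F) (3F , 2F) (2F , 2F) ∷
     alternating (1F , 3F) (2F , 3F) (3F , 3F) (3F , 2F) (3F , 1F) ∷
     alternating (1F , 3F) (2F , 3F) (2F , 2F) (3F , 2F) (3F , 3F) ∷
     alternating (1F , 3F) (1F , 2F) (2F , 2F) (3F , 2F) (3F , 3F) ∷
     alternating (2F , 0F) (3F , 0F) (3F , 1F) (3F , 2F) (3F , 3F) ∷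
     alternating (2F , 0F) (2F , 1F) (3F , 1F) (3F , 2F) (3F , 3F) ∷
     alternating (2F , 0F) (2F , 1F) (2F , 2F) (3F , 2F) (3F , 3F) ∷
     alternating (2F , 1F) (3F , 1F) (3F , 2F) (3F , 3F) (2F , 3F) ∷
     alternating (2F , 1F) (2F , 2F) (3F , 2F) (3F , 3F) (2F , 3F) ∷
     alternating (2F , 1F) (2F , 2F) (2F , 3F) (3F , 3F) (3F , 2F) ∷
     sameColour (2F , 2F) (3F , 2F) (3F , 3F) ∷
     alternating (2F , 2F) (3F , 2F) (3F , 3F) (2F , 3F) (2F , 2F) ∷
     alternating (2F , 2F) (2F , 3F) (3F , 3F) (3F , 2F) (3F , 1F) ∷
     alternating (2F , 2F) (2F , 1F) (3F , 1F) (3F , 2F) (3F , 3F) ∷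
     sameColour (2F , 3F) (3F , 3F) (3F , 2F) ∷
     alternating (2F , 3F) (3F , 3F) (3F , 2F) (3F , 1F) (3F , 0F) ∷
     alternating (3F , 1F) (2F , 1F) (2F , 2F) (3F , 2F) (3F , 3F) ∷
     sameColour (3F , 1F) (3F , 2F) (3F , 3F) ∷ []) ∷ []
  }

noStar22 : ¬ StarColourable (Grid 2 2) 2
noStar22 = Refutation.refutes certificate22 _ _

noStar23 : ¬ StarColourable (Grid 2 3) 3
noStar23 = Refutation.refutes certificate23 _ _

noStar33 : ¬ StarColourable (Grid 3 3) 4
noStar33 = Refutation.refutes certificate33 _ _

noStar35 : ¬ StarColourable (Grid 3 5) 5
noStar35 = Refutation.refutes certificate35 _ _

noStar44 : ¬ StarColourable (Grid 4 4) 5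
noStar44 = Refutation.refutes certificate44 _ _

inherit : ∀ {a b m n k} → ¬ StarColourable (Grid a b) k → a ≤ m → b ≤ n →
          ¬ StarColourable (Grid m n) k
inherit none a≤m b≤n = none ∘ restrict (subgrid a≤m b≤n)

inheritᵀ : ∀ {a b m n k} → ¬ StarColourable (Grid a b) k → b ≤ m → a ≤ n →
           ¬ StarColourable (Grid m n) k
inheritᵀ none b≤m a≤n = none ∘ restrict (transposed b≤m a≤n)

largeGrid : ∀ m n → 2 ≤ m → 2 ≤ n → ¬ (m ≡ 2 × n ≡ 2) →
  ¬ ((m ≡ 2 × 3 ≤ n) ⊎ (3 ≤ m × n ≡ 2)) →
  ¬ (((m ≡ 3 ⊎ m ≡ 4) × n ≡ 3) ⊎ (m ≡ 3 × (n ≡ 3 ⊎ n ≡ 4))) →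
  (3 ≤ m × 5 ≤ n) ⊎ (5 ≤ m × 3 ≤ n) ⊎ (m ≡ 4 × n ≡ 4)
largeGrid 0 _ () _ _ _ _
largeGrid 1 _ (s≤s ()) _ _ _ _
largeGrid _ 0 _ () _ _ _
largeGrid _ 1 _ (s≤s ()) _ _ _
largeGrid 2 2 _ _ not22 _ _ = ⊥-elim (not22 (refl , refl))
largeGrid 2 (suc (suc (suc n))) _ _ _ notLadder _ =
  ⊥-elim (notLadder (inj₁ (refl , m≤m+n 3 n)))
largeGrid (suc (suc (suc m))) 2 _ _ _ notLadder _ =
  ⊥-elim (notLadder (inj₂ (m≤m+n 3 m , refl)))
largeGrid 3 3 _ _ _ _ notSmall = ⊥-elim (notSmall (inj₁ (inj₁ refl , refl)))
largeGrid 3 4 _ _ _ _ notSmall = ⊥-elim (notSmall (inj₂ (refl , inj₂ refl)))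
largeGrid 4 3 _ _ _ _ notSmall = ⊥-elim (notSmall (inj₁ (inj₂ refl , refl)))
largeGrid 4 4 _ _ _ _ _ = inj₂ (inj₂ (refl , refl))
largeGrid 3 (suc (suc (suc (suc (suc n))))) _ _ _ _ _ = inj₁ (≤-refl , m≤m+n 5 n)
largeGrid 4 (suc (suc (suc (suc (suc n))))) _ _ _ _ _ = inj₁ (m≤m+n 3 1 , m≤m+n 5 n)
largeGrid (suc (suc (suc (suc (suc m))))) (suc (suc (suc n))) _ _ _ _ _ =
  inj₂ (inj₁ (m≤m+n 5 m , m≤m+n 3 n))

theorem6 : (m n : ℕ) → 2 ≤ m → 2 ≤ n →
    ((m ≡ 2 × n ≡ 2) → StarChromaticIndex≡ (P m □ P n) 3) ×
    (((m ≡ 2 × 3 ≤ n) ⊎ (3 ≤ m × n ≡ 2)) → StarChromaticIndex≡ (P m □ P n) 4) ×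
    ((((m ≡ 3 ⊎ m ≡ 4) × n ≡ 3) ⊎ (m ≡ 3 × (n ≡ 3 ⊎ n ≡ 4))) →
      StarChromaticIndex≡ (P m □ P n) 5) ×
    (¬ (m ≡ 2 × n ≡ 2) → ¬ ((m ≡ 2 × 3 ≤ n) ⊎ (3 ≤ m × n ≡ 2)) →
      ¬ (((m ≡ 3 ⊎ m ≡ 4) × n ≡ 3) ⊎ (m ≡ 3 × (n ≡ 3 ⊎ n ≡ 4))) →
      StarChromaticIndex≡ (P m □ P n) 6)
theorem6 m n 2≤m 2≤n = square , ladders , small , otherwise
  where
  square : (m ≡ 2 × n ≡ 2) → StarChromaticIndex≡ (P m □ P n) 3
  square (refl , refl) = grid22 , fewerColours noStar22
  ladders : (m ≡ 2 × 3 ≤ n) ⊎ (3 ≤ m × n ≡ 2) → StarChromaticIndex≡ (P m □ P n) 4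
  ladders (inj₁ (refl , 3≤n)) = ladder n , fewerColours (inherit noStar23 ≤-refl 3≤n)
  ladders (inj₂ (3≤m , refl)) =
    restrict □-swap (ladder m) , fewerColours (inheritᵀ noStar23 3≤m ≤-refl)
  small : ((m ≡ 3 ⊎ m ≡ 4) × n ≡ 3) ⊎ (m ≡ 3 × (n ≡ 3 ⊎ n ≡ 4)) →
          StarChromaticIndex≡ (P m □ P n) 5
  small (inj₁ (inj₁ refl , refl)) = grid33 , fewerColours noStar33
  small (inj₁ (inj₂ refl , refl)) =
    restrict □-swap grid34 , fewerColours (inherit noStar33 (m≤m+n 3 1) ≤-refl)
  small (inj₂ (refl , inj₁ refl)) = grid33 , fewerColours noStar33
  small (inj₂ (refl , inj₂ refl)) = grid34 , fewerColours (inherit noStar33 ≤-refl (m≤m+n 3 1))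
  otherwise : ¬ (m ≡ 2 × n ≡ 2) → ¬ ((m ≡ 2 × 3 ≤ n) ⊎ (3 ≤ m × n ≡ 2)) →
    ¬ (((m ≡ 3 ⊎ m ≡ 4) × n ≡ 3) ⊎ (m ≡ 3 × (n ≡ 3 ⊎ n ≡ 4))) →
    StarChromaticIndex≡ (P m □ P n) 6
  otherwise not22 notLadder notSmall = torus m n , fewerColours noStar5
    where
    noStar5 : ¬ StarColourable (Grid m n) 5
    noStar5 with largeGrid m n 2≤m 2≤n not22 notLadder notSmall
    ... | inj₁ (3≤m , 5≤n)          = inherit noStar35 3≤m 5≤n
    ... | inj₂ (inj₁ (5≤m , 3≤n))  = inheritᵀ noStar35 5≤m 3≤n
    ... | inj₂ (inj₂ (refl , refl)) = noStar44
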